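{- Let $k$ be a non-negative integer and let $G\in\Delta_k$. Then for every vertex $v$ of $G$, the graph $G*v\setminus v$ has linear rank-width at most $k$.
   Context: Graphs are finite and simple. $G*v$ is the local complementation of $G$ at $v$: the induced subgraph on the neighborhood of $v$ is replaced by its complement. $G*v\setminus v$ denotes $G*v$ with $v$ deleted. For $X\subseteq V(G)$, $\mathrm{cutrk}_G(X)$ is the binary rank of the submatrix of the adjacency matrix with rows $X$ and columns $V(G)\setminus X$. A linear layout is an ordering $(v_1,\dots,v_n)$ of $V(G)$ with width $\max_i\mathrm{cutrk}_G(\{v_1,\dots,v_i\})$ (or $0$ if $n\le1$). The linear rank-width is the minimum width of a linear layout. A delta composition of $G_1,G_2,G_3$ is obtained from their disjoint union by choosing $v_i\in V(G_i)$ and adding the triangle $v_1v_2v_3$. $\Delta_0=\{K_2\}$, and for $i\ge1$, $\Delta_i$ is the set of delta compositions of three (not necessarily distinct) graphs in $\Delta_{i-1}$, up to isomorphism. -}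

module Defs where

open import Data.Nat using (ℕ; zero; suc; _+_; _≤_; _<ᵇ_)
open import Data.Bool using (Bool; true; false; _∧_; _∨_; _xor_; not)
open import Data.Fin using (Fin; zero; suc; toℕ; splitAt; punchIn; _≟_)
open import Data.Fin.Subset using (Subset; _∈_; _∉_; _⊆_; ∣_∣; Nonempty)
open import Data.Fin.Permutation using (Permutation; Permutation′; _⟨$⟩ʳ_; _⟨$⟩ˡ_)
open import Data.Vec using (tabulate; lookup)
open import Data.Sum using (_⊎_; inj₁; inj₂)
open import Data.Product using (Σ; ∃; _×_)
open import Relation.Binary.PropositionalEquality using (_≡_)
open import Relation.Nullary.Decidable using (⌊_⌋)

-- Graphs on the vertex set Fin n, given by a Boolean adjacency matrix.
-- (Simplicity -- symmetry and irreflexivity -- is a property; every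
-- graph in Δ_k is simple, see IsSimple / the definitions below.)

Graph : ℕ → Set
Graph n = Fin n → Fin n → Bool

IsSimple : ∀ {n} → Graph n → Set
IsSimple {n} G = (∀ x y → G x y ≡ G y x) × (∀ x → G x x ≡ false)

_==_ : ∀ {n} → Fin n → Fin n → Bool
x == y = ⌊ x ≟ y ⌋

_≅_ : ∀ {m n} → Graph m → Graph n → Set
_≅_ {m} {n} G H = Σ (Permutation m n) λ σ →
  ∀ x y → H (σ ⟨$⟩ʳ x) (σ ⟨$⟩ʳ y) ≡ G x y

K₂ : Graph 2
K₂ x y = not (x == y)

data Part (a b c : ℕ) : Set where
  p₁ : Fin a → Part a b c
  p₂ : Fin b → Part a b c
  p₃ : Fin c → Part a b c

decode : ∀ a b c → Fin (a + (b + c)) → Part a b c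
decode a b c x with splitAt a x
... | inj₁ i = p₁ i
... | inj₂ j with splitAt b j
...   | inj₁ k = p₂ k
...   | inj₂ l = p₃ l

composeAdj : ∀ {a b c} → Graph a → Graph b → Graph c →
             Fin a → Fin b → Fin c → Part a b c → Part a b c → Bool
composeAdj G₁ G₂ G₃ v₁ v₂ v₃ (p₁ x) (p₁ y) = G₁ x y
composeAdj G₁ G₂ G₃ v₁ v₂ v₃ (p₂ x) (p₂ y) = G₂ x y
composeAdj G₁ G₂ G₃ v₁ v₂ v₃ (p₃ x) (p₃ y) = G₃ x y
composeAdj G₁ G₂ G₃ v₁ v₂ v₃ (p₁ x) (p₂ y) = (x == v₁) ∧ (y == v₂)
composeAdj G₁ G₂ G₃ v₁ v₂ v₃ (p₁ x) (p₃ y) = (x == v₁) ∧ (y == v₃)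
composeAdj G₁ G₂ G₃ v₁ v₂ v₃ (p₂ x) (p₁ y) = (x == v₂) ∧ (y == v₁)
composeAdj G₁ G₂ G₃ v₁ v₂ v₃ (p₂ x) (p₃ y) = (x == v₂) ∧ (y == v₃)
composeAdj G₁ G₂ G₃ v₁ v₂ v₃ (p₃ x) (p₁ y) = (x == v₃) ∧ (y == v₁)
composeAdj G₁ G₂ G₃ v₁ v₂ v₃ (p₃ x) (p₂ y) = (x == v₃) ∧ (y == v₂)

deltaCompose : ∀ {a b c} → Graph a → Graph b → Graph c →
               Fin a → Fin b → Fin c → Graph (a + (b + c))
deltaCompose {a} {b} {c} G₁ G₂ G₃ v₁ v₂ v₃ x y =
  composeAdj G₁ G₂ G₃ v₁ v₂ v₃ (decode a b c x) (decode a b c y)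

data Δ : ℕ → ∀ {n} → Graph n → Set where
  base : ∀ {n} {G : Graph n} → K₂ ≅ G → Δ zero G
  step : ∀ {k a b c n} {G₁ : Graph a} {G₂ : Graph b} {G₃ : Graph c}
           {G : Graph n} →
         Δ k G₁ → Δ k G₂ → Δ k G₃ →
         (v₁ : Fin a) (v₂ : Fin b) (v₃ : Fin c) →
         deltaCompose G₁ G₂ G₃ v₁ v₂ v₃ ≅ G →
         Δ (suc k) G

_✶_ : ∀ {n} → Graph n → Fin n → Graph n
(G ✶ v) x y = G x y xor (G v x ∧ G v y ∧ not (x == y))

_∖_ : ∀ {n} → Graph (suc n) → Fin (suc n) → Graph n
(G ∖ v) x y = G (punchIn v x) (punchIn v y)

⊕-sum : ∀ {n} → (Fin n → Bool) → Bool
⊕-sum {zero}  f = false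
⊕-sum {suc n} f = f zero xor ⊕-sum (λ i → f (suc i))

-- The rows indexed by S (S ⊆ X) of the matrix A_G[X, V∖X] are linearly
-- independent over GF(2): every nonempty subfamily T ⊆ S has a nonzero sum,
-- i.e. some column c ∉ X where the GF(2)-sum of the rows in T is 1.
IndependentRows : ∀ {n} → Graph n → Subset n → Subset n → Set
IndependentRows {n} G X S =
  ∀ (T : Subset n) → T ⊆ S → Nonempty T →
  ∃ λ (c : Fin n) → c ∉ X × ⊕-sum (λ r → lookup T r ∧ G r c) ≡ true

-- cutrk_G(X) ≤ r : the binary rank of A_G[X, V∖X] (the maximum number of
-- GF(2)-linearly independent rows) is at most r.
CutRankAtMost : ∀ {n} → Graph n → Subset n → ℕ → Set
CutRankAtMost {n} G X r =
  ∀ (S : Subset n) → S ⊆ X → IndependentRows G X S → ∣ S ∣ ≤ r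

-- A linear layout is a bijection σ : positions → vertices
-- (v_i = σ(i)); the prefix {v_1,…,v_i} for i ∈ {0,…,n}.
prefix : ∀ {n} → Permutation′ n → ℕ → Subset n
prefix σ i = tabulate λ v → toℕ (σ ⟨$⟩ˡ v) <ᵇ i

LayoutWidthAtMost : ∀ {n} → Graph n → Permutation′ n → ℕ → Set
LayoutWidthAtMost {n} G σ k = ∀ i → i ≤ n → CutRankAtMost G (prefix σ i) k

LinearRankWidthAtMost : ∀ {n} → Graph n → ℕ → Set
LinearRankWidthAtMost {n} G k = ∃ λ (σ : Permutation′ n) → LayoutWidthAtMost G σ k

-- Rank bounds are carried as factorisations over GF(2) and turned into the cut-rank bound of
-- the statement by Gaussian elimination. The theorem is proved by induction along Δ_k for a
-- stronger invariant at every vertex w of G: G * w ∖ w has a layout of width k which, with w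
-- added to both sides of every cut, still has width k + 1. For u in G₁ of the composition of
-- G₁, G₂, G₃ along v₁v₂v₃, lay out G₂ with v₂ last, then G₁ * u ∖ u, then G₃ with v₃ first:
-- undoing the complementation at v₂ (v₃) is a rank-one change, so these parts have width
-- k + 1. Across a cut inside G₁ the triangle adds a rank-one matrix when u ≠ v₁; when u = v₁
-- the complementation turns v₂ and v₃ into copies of the row and column of v₁ in G₁ * v₁,
-- which is what the second invariant bounds, and conversely the first invariant of G₁ at v₁
-- gives the second one of the composition with two extra vectors.

module Submission where

open import Algebra using (CommutativeRing)
open import Data.Bool using (Bool; true; false; not; _∧_; _xor_; if_then_else_)
import Data.Bool as Bool
open import Data.Bool.Properties
  using ( ∧-comm; ∧-assoc; ∧-zeroʳ; ∧-identityʳ; ∧-distribˡ-xor; ∧-distribʳ-xor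
        ; xor-identityʳ; xor-comm; xor-assoc; xor-same; ¬-not; T-≡; xor-∧-commutativeRing)
open import Algebra.Properties.CommutativeSemigroup
  (CommutativeRing.+-commutativeSemigroup xor-∧-commutativeRing) using (interchange)
open import Data.Empty using (⊥-elim)
open import Data.Fin using (Fin; zero; suc; _≟_; toℕ; fromℕ<; punchIn; punchOut; _↑ˡ_; _↑ʳ_; splitAt; join)
open import Data.Fin.Properties using (any?)
import Data.Fin.Properties as Finₚ
open import Data.Fin.Permutation using (Permutation′; permutation; _⟨$⟩ʳ_; _⟨$⟩ˡ_; inverseˡ; inverseʳ; ↔⇒≡)
open import Data.Fin.Subset using (Subset; _∈_; _∉_; _⊆_; ∣_∣)
open import Data.Nat using (ℕ; zero; suc; pred; _+_; _≤_; _<_; z≤n; s≤s; _≤?_)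
import Data.Nat.Properties as ℕₚ
open import Data.Nat.Tactic.RingSolver using (solve-∀)
open import Data.Product using (Σ; ∃; _×_; _,_; proj₁; proj₂)
import Data.Product as Product
open import Data.Sum using (_⊎_; inj₁; inj₂)
import Data.Sum as Sum
open import Data.Unit using (tt)
open import Data.Vec using (_∷_; []; lookup; tabulate)
open import Data.Vec.Properties using (lookup∘tabulate; []=⇒lookup; lookup⇒[]=)
open import Function using (_∘_; id)
open import Function.Bundles using (Equivalence)
open import Relation.Binary.Definitions using (DecidableEquality)
open import Relation.Binary.PropositionalEquality
open import Relation.Nullary using (¬_; Dec; yes; no; contradiction)
open import Relation.Nullary.Decidable using (⌊_⌋; map′)
open import Relation.Unary using (｛_｝; _∪_; ∅; U)
open import Defs

module DecidableEquality⌊⌋ {A : Set} (_≟_ : DecidableEquality A) where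

  ⌊≟⌋-refl : ∀ x → ⌊ x ≟ x ⌋ ≡ true
  ⌊≟⌋-refl x with x ≟ x
  ... | yes _ = refl
  ... | no x≢x = ⊥-elim (x≢x refl)

  ⌊≟⌋-≢ : ∀ {x y} → x ≢ y → ⌊ x ≟ y ⌋ ≡ false
  ⌊≟⌋-≢ {x} {y} x≢y with x ≟ y
  ... | yes x≡y = ⊥-elim (x≢y x≡y)
  ... | no _ = refl

  ⌊≟⌋⇒≡ : ∀ {x y} → ⌊ x ≟ y ⌋ ≡ true → x ≡ y
  ⌊≟⌋⇒≡ {x} {y} eq with x ≟ y
  ... | yes x≡y = x≡y
  ⌊≟⌋⇒≡ () | no _

  not⌊≟⌋⇒≢ : ∀ {x y} → not ⌊ x ≟ y ⌋ ≡ true → x ≢ y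
  not⌊≟⌋⇒≢ {x} ne refl with () ← trans (sym ne) (cong not (⌊≟⌋-refl x))

  ⌊≟⌋-injective : ∀ {B : Set} (_≟′_ : DecidableEquality B) {f : B → A} →
                  (∀ {x y} → f x ≡ f y → x ≡ y) → ∀ x y → ⌊ x ≟′ y ⌋ ≡ ⌊ f x ≟ f y ⌋
  ⌊≟⌋-injective _≟′_ {f} f-injective x y with x ≟′ y | f x ≟ f y
  ... | yes _    | yes _     = refl
  ... | no _     | no _      = refl
  ... | yes refl | no fx≢fx  = contradiction refl fx≢fx
  ... | no x≢y   | yes fx≡fy = contradiction (f-injective fx≡fy) x≢y

module Fin⌊≟⌋ {n : ℕ} = DecidableEquality⌊⌋ (_≟_ {n})

suc==suc : ∀ {n} (x y : Fin n) → (suc x == suc y) ≡ (x == y)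
suc==suc x y = by-cases (x ≟ y)
  where
  by-cases : Dec (x ≡ y) → (suc x == suc y) ≡ (x == y)
  open Fin⌊≟⌋
  by-cases (yes refl) = trans (⌊≟⌋-refl (suc x)) (sym (⌊≟⌋-refl x))
  by-cases (no x≢y)   = trans (⌊≟⌋-≢ (x≢y ∘ Finₚ.suc-injective)) (sym (⌊≟⌋-≢ x≢y))

-- GF(2) sums

⊕-sum-cong : ∀ {n} {f g : Fin n → Bool} → (∀ i → f i ≡ g i) → ⊕-sum f ≡ ⊕-sum g
⊕-sum-cong {zero}  f≗g = refl
⊕-sum-cong {suc n} f≗g = cong₂ _xor_ (f≗g zero) (⊕-sum-cong (f≗g ∘ suc))

⊕-sum-false : ∀ {n} {f : Fin n → Bool} → (∀ i → f i ≡ false) → ⊕-sum f ≡ false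
⊕-sum-false {zero}  f≗0 = refl
⊕-sum-false {suc n} f≗0 = cong₂ _xor_ (f≗0 zero) (⊕-sum-false (f≗0 ∘ suc))

⊕-sum-xor : ∀ {n} (f g : Fin n → Bool) → ⊕-sum (λ i → f i xor g i) ≡ ⊕-sum f xor ⊕-sum g
⊕-sum-xor {zero}  f g = refl
⊕-sum-xor {suc n} f g =
  trans (cong ((f zero xor g zero) xor_) (⊕-sum-xor (f ∘ suc) (g ∘ suc)))
        (interchange (f zero) (g zero) (⊕-sum (f ∘ suc)) (⊕-sum (g ∘ suc)))

⊕-sum-∧ˡ : ∀ {n} b (f : Fin n → Bool) → ⊕-sum (λ i → b ∧ f i) ≡ b ∧ ⊕-sum f
⊕-sum-∧ˡ true  f = refl
⊕-sum-∧ˡ {n} false f = ⊕-sum-false {n} (λ _ → refl)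

⊕-sum-∧ʳ : ∀ {n} b (f : Fin n → Bool) → ⊕-sum (λ i → f i ∧ b) ≡ ⊕-sum f ∧ b
⊕-sum-∧ʳ b f = trans (⊕-sum-cong (λ i → ∧-comm (f i) b)) (trans (⊕-sum-∧ˡ b f) (∧-comm b _))

⊕-sum-point : ∀ {n} (s : Fin n) (f : Fin n → Bool) → ⊕-sum (λ x → (x == s) ∧ f x) ≡ f s
⊕-sum-point {suc n} zero f = trans (cong (f zero xor_) (⊕-sum-false {n} (λ _ → refl))) (xor-identityʳ (f zero))
⊕-sum-point {suc n} (suc s) f =
  trans (⊕-sum-cong (λ x → cong (_∧ f (suc x)) (suc==suc x s))) (⊕-sum-point s (f ∘ suc))

⊕-sum-comm : ∀ {m n} (g : Fin m → Fin n → Bool) →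
             ⊕-sum (λ i → ⊕-sum (g i)) ≡ ⊕-sum (λ j → ⊕-sum (λ i → g i j))
⊕-sum-comm {zero} {n} g = sym (⊕-sum-false {n} (λ _ → refl))
⊕-sum-comm {suc m} g =
  trans (cong (⊕-sum (g zero) xor_) (⊕-sum-comm (g ∘ suc)))
        (sym (⊕-sum-xor (g zero) (λ j → ⊕-sum (λ i → g (suc i) j))))

⊕-sum≡true⇒∃ : ∀ {n} (f : Fin n → Bool) → ⊕-sum f ≡ true → ∃ λ i → f i ≡ true
⊕-sum≡true⇒∃ {suc n} f sum≡1 with f zero in f₀
... | true  = zero , f₀
... | false = let i , fi = ⊕-sum≡true⇒∃ (f ∘ suc) sum≡1 in suc i , fi

-- Rank bounds as factorisations

RankAtMost : {A B : Set} → (A → B → Bool) → (A → Set) → (B → Set) → ℕ → Set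
RankAtMost {A} {B} M R C r =
  Σ (A → Fin r → Bool) λ α → Σ (Fin r → B → Bool) λ β →
  ∀ {x c} → R x → C c → M x c ≡ ⊕-sum (λ j → α x j ∧ β j c)

module _ {A B : Set} {M : A → B → Bool} {R : A → Set} {C : B → Set} where

  rank-of-zero : ∀ {r} → (∀ {x c} → R x → C c → M x c ≡ false) → RankAtMost M R C r
  rank-of-zero {r} M≡0 =
    (λ _ _ → false) , (λ _ _ → false) , λ x∈R c∈C → trans (M≡0 x∈R c∈C) (sym (⊕-sum-false {r} (λ _ → refl)))

  rank-restrict : ∀ {R′ : A → Set} {C′ : B → Set} {r} →
                  (∀ {x} → R′ x → R x) → (∀ {c} → C′ c → C c) →
                  RankAtMost M R C r → RankAtMost M R′ C′ r
  rank-restrict R′⊆R C′⊆C (α , β , M≡αβ) = α , β , λ x∈R′ c∈C′ → M≡αβ (R′⊆R x∈R′) (C′⊆C c∈C′)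

  rank-add-outer : ∀ {r} {M₀ : A → B → Bool} (a : A → Bool) (b : B → Bool) →
             (∀ {x c} → R x → C c → M x c ≡ (a x ∧ b c) xor M₀ x c) →
             RankAtMost M₀ R C r → RankAtMost M R C (suc r)
  rank-add-outer {M₀ = M₀} a b M≡ab+M₀ (α , β , M₀≡αβ) =
    (λ x → λ { zero → a x ; (suc j) → α x j }) , (λ { zero → b ; (suc j) → β j }) ,
    λ {x} {c} x∈R c∈C → trans (M≡ab+M₀ x∈R c∈C) (cong ((a x ∧ b c) xor_) (M₀≡αβ x∈R c∈C))

  -- f and g reindex the rows and columns and ρ and γ mask them; f and g only matter where the masks are true.
  rank-pullback : ∀ {A′ B′ : Set} {M′ : A′ → B′ → Bool} {R′ : A′ → Set} {C′ : B′ → Set} {r}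
    (f : A → A′) (g : B → B′) (ρ : A → Bool) (γ : B → Bool) →
    (∀ {x} → R x → ρ x ≡ true → R′ (f x)) → (∀ {c} → C c → γ c ≡ true → C′ (g c)) →
    (∀ {x c} → R x → C c → M x c ≡ ρ x ∧ γ c ∧ M′ (f x) (g c)) →
    RankAtMost M′ R′ C′ r → RankAtMost M R C r
  rank-pullback {M′ = M′} {r = r} f g ρ γ rows cols M≡ (α , β , M′≡αβ) =
    (λ x j → ρ x ∧ α (f x) j) , (λ j c → γ c ∧ β j (g c)) , factor
    where
    factor : ∀ {x c} → R x → C c → M x c ≡ ⊕-sum (λ j → (ρ x ∧ α (f x) j) ∧ (γ c ∧ β j (g c)))
    factor {x} {c} x∈R c∈C with ρ x in ρx | γ c in γc | M≡ x∈R c∈C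
    ... | false | _     | M≡0 = trans M≡0 (sym (⊕-sum-false {r} (λ _ → refl)))
    ... | true  | false | M≡0 = trans M≡0 (sym (⊕-sum-false (λ j → ∧-zeroʳ (α (f x) j))))
    ... | true  | true  | M≡M′ = trans M≡M′ (M′≡αβ (rows x∈R ρx) (cols c∈C γc))

module _ {A B : Set} {M : A → B → Bool} {R : A → Set} {C : B → Set} {r : ℕ} where

  rank-insert-row : (_≟_ : DecidableEquality A) (v : A) → RankAtMost M R C r → RankAtMost M (｛ v ｝ ∪ R) C (suc r)
  rank-insert-row _≟_ v rank = rank-add-outer (λ x → ⌊ x ≟ v ⌋) (M v) entry
    (rank-pullback {M = λ x c → not ⌊ x ≟ v ⌋ ∧ M x c} id id (λ x → not ⌊ x ≟ v ⌋) (λ _ → true)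
      rows (λ c∈C _ → c∈C) (λ _ _ → refl) rank)
    where
    open DecidableEquality⌊⌋ _≟_
    entry : ∀ {x c} → (｛ v ｝ ∪ R) x → C c → M x c ≡ (⌊ x ≟ v ⌋ ∧ M v c) xor (not ⌊ x ≟ v ⌋ ∧ M x c)
    entry {x} {c} _ _ with x ≟ v
    ... | yes refl = sym (xor-identityʳ (M x c))
    ... | no _     = refl
    rows : ∀ {x} → (｛ v ｝ ∪ R) x → not ⌊ x ≟ v ⌋ ≡ true → R x
    rows (inj₁ refl) x≢v = contradiction refl (not⌊≟⌋⇒≢ x≢v)
    rows (inj₂ x∈R)  _   = x∈R

  rank-insert-column : (_≟_ : DecidableEquality B) (v : B) → RankAtMost M R C r → RankAtMost M R (｛ v ｝ ∪ C) (suc r)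
  rank-insert-column _≟_ v rank = rank-add-outer (λ x → M x v) (λ c → ⌊ c ≟ v ⌋) entry
    (rank-pullback {M = λ x c → not ⌊ c ≟ v ⌋ ∧ M x c} id id (λ _ → true) (λ c → not ⌊ c ≟ v ⌋)
      (λ x∈R _ → x∈R) cols (λ _ _ → refl) rank)
    where
    open DecidableEquality⌊⌋ _≟_
    entry : ∀ {x c} → R x → (｛ v ｝ ∪ C) c → M x c ≡ (M x v ∧ ⌊ c ≟ v ⌋) xor (not ⌊ c ≟ v ⌋ ∧ M x c)
    entry {x} {c} _ _ with c ≟ v
    ... | yes refl = trans (sym (∧-identityʳ (M x c))) (sym (xor-identityʳ _))
    ... | no _     = cong (_xor M x c) (sym (∧-zeroʳ (M x v)))
    cols : ∀ {c} → (｛ v ｝ ∪ C) c → not ⌊ c ≟ v ⌋ ≡ true → C c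
    cols (inj₁ refl) c≢v = contradiction refl (not⌊≟⌋⇒≢ c≢v)
    cols (inj₂ c∈C)  _   = c∈C

-- Linear independence over GF(2)

size : ∀ {n} → (Fin n → Bool) → ℕ
size {zero}  S = 0
size {suc n} S = (if S zero then 1 else 0) + size (S ∘ suc)

size-cong : ∀ {n} {S S′ : Fin n → Bool} → (∀ x → S x ≡ S′ x) → size S ≡ size S′
size-cong {zero}  S≗S′ = refl
size-cong {suc n} S≗S′ = cong₂ _+_ (cong (if_then 1 else 0) (S≗S′ zero)) (size-cong (S≗S′ ∘ suc))

size-false : ∀ {n} {S : Fin n → Bool} → (∀ x → S x ≡ false) → size S ≡ 0
size-false {zero}          S≗0 = refl
size-false {suc n} {S} S≗0 rewrite S≗0 zero = size-false (S≗0 ∘ suc)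

_-ᵇ_ : ∀ {n} → (Fin n → Bool) → Fin n → Fin n → Bool
(S -ᵇ s) x = S x ∧ not (x == s)

size-remove : ∀ {n} (S : Fin n → Bool) {s} → S s ≡ true → size S ≡ suc (size (S -ᵇ s))
size-remove {suc n} S {zero} Ss rewrite Ss = cong suc (size-cong (λ x → sym (∧-identityʳ (S (suc x)))))
size-remove {suc n} S {suc s} Ss = begin
  size S
    ≡⟨ cong ((if S zero then 1 else 0) +_) (size-remove (S ∘ suc) Ss) ⟩
  (if S zero then 1 else 0) + suc (size ((S ∘ suc) -ᵇ s))
    ≡⟨ ℕₚ.+-suc _ _ ⟩
  suc ((if S zero then 1 else 0) + size ((S ∘ suc) -ᵇ s))
    ≡⟨ cong suc (cong₂ _+_ (cong (if_then 1 else 0) (sym (∧-identityʳ (S zero))))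
                           (size-cong λ x → cong (λ b → S (suc x) ∧ not b) (sym (suc==suc x s)))) ⟩
  suc (size (S -ᵇ suc s)) ∎
  where open ≡-Reasoning

LinearlyIndependent : ∀ {n r} → (Fin n → Bool) → (Fin n → Fin r → Bool) → Set
LinearlyIndependent {n} S a =
  ∀ (T : Fin n → Bool) → (∀ {x} → T x ≡ true → S x ≡ true) → (∃ λ x → T x ≡ true) →
  ∃ λ j → ⊕-sum (λ x → T x ∧ a x j) ≡ true

all-false : ∀ {n} {P : Fin n → Bool} → ¬ (∃ λ x → P x ≡ true) → ∀ x → P x ≡ false
all-false none x = ¬-not (λ Px → none (x , Px))

∧-true : ∀ {a b} → a ∧ b ≡ true → a ≡ true × b ≡ true
∧-true {true} b≡1 = refl , b≡1

module _ {n r} {S : Fin n → Bool} {a : Fin n → Fin (suc r) → Bool} (indep : LinearlyIndependent S a) where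

  drop-zero-coordinate : (∀ x → S x ∧ a x zero ≡ false) → LinearlyIndependent S (λ x j → a x (suc j))
  drop-zero-coordinate S∧a₀≡0 T T⊆S nonempty with indep T T⊆S nonempty
  ... | suc j , sum≡1 = j , sum≡1
  ... | zero  , sum≡1 = contradiction (trans (sym sum≡1) (⊕-sum-false T∧a₀≡0)) λ ()
    where
    T∧a₀≡0 : ∀ x → T x ∧ a x zero ≡ false
    T∧a₀≡0 x with T x in Tx
    ... | false = refl
    ... | true  = subst (λ b → b ∧ a x zero ≡ false) (T⊆S Tx) (S∧a₀≡0 x)

  eliminate-pivot : ∀ {s} → S s ≡ true → a s zero ≡ true →
    LinearlyIndependent (S -ᵇ s) (λ x j → a x (suc j) xor (a x zero ∧ a s (suc j)))
  eliminate-pivot {s} Ss as₀ T T⊆S-s (x₀ , Tx₀) = result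
    where
    open ≡-Reasoning
    p : Bool
    p = ⊕-sum (λ x → T x ∧ a x zero)
    T* : Fin n → Bool
    T* x = T x xor (p ∧ (x == s))
    sum-T* : ∀ f → ⊕-sum (λ x → T* x ∧ f x) ≡ ⊕-sum (λ x → T x ∧ f x) xor (p ∧ f s)
    sum-T* f = begin
      ⊕-sum (λ x → T* x ∧ f x)
        ≡⟨ ⊕-sum-cong (λ x → trans (∧-distribʳ-xor (f x) (T x) _) (cong ((T x ∧ f x) xor_) (∧-assoc p (x == s) (f x)))) ⟩
      ⊕-sum (λ x → (T x ∧ f x) xor (p ∧ ((x == s) ∧ f x)))
        ≡⟨ ⊕-sum-xor (λ x → T x ∧ f x) (λ x → p ∧ ((x == s) ∧ f x)) ⟩
      ⊕-sum (λ x → T x ∧ f x) xor ⊕-sum (λ x → p ∧ ((x == s) ∧ f x))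
        ≡⟨ cong (⊕-sum (λ x → T x ∧ f x) xor_) (trans (⊕-sum-∧ˡ p (λ x → (x == s) ∧ f x)) (cong (p ∧_) (⊕-sum-point s f))) ⟩
      ⊕-sum (λ x → T x ∧ f x) xor (p ∧ f s) ∎
    T*⊆S : ∀ {x} → T* x ≡ true → S x ≡ true
    T*⊆S {x} T*x with T x in Tx
    ... | true  = proj₁ (∧-true (T⊆S-s Tx))
    ... | false = subst (λ y → S y ≡ true) (sym (Fin⌊≟⌋.⌊≟⌋⇒≡ (proj₂ (∧-true {p} T*x)))) Ss
    T*x₀ : T* x₀ ≡ true
    T*x₀ with x₀ == s | proj₂ (∧-true {S x₀} (T⊆S-s Tx₀))
    ... | false | _ = trans (cong (_xor (p ∧ false)) Tx₀) (cong not (∧-zeroʳ p))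
    ... | true  | ()
    first-coordinate-vanishes : ⊕-sum (λ x → T* x ∧ a x zero) ≡ false
    first-coordinate-vanishes = begin
      ⊕-sum (λ x → T* x ∧ a x zero) ≡⟨ sum-T* (λ x → a x zero) ⟩
      p xor (p ∧ a s zero)          ≡⟨ cong (λ b → p xor (p ∧ b)) as₀ ⟩
      p xor (p ∧ true)              ≡⟨ cong (p xor_) (∧-identityʳ p) ⟩
      p xor p                       ≡⟨ xor-same p ⟩
      false                         ∎
    later-coordinate : ∀ j → ⊕-sum (λ x → T x ∧ (a x (suc j) xor (a x zero ∧ a s (suc j))))
                             ≡ ⊕-sum (λ x → T* x ∧ a x (suc j))
    later-coordinate j = begin
      ⊕-sum (λ x → T x ∧ (a x (suc j) xor (a x zero ∧ a s (suc j))))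
        ≡⟨ ⊕-sum-cong (λ x → trans (∧-distribˡ-xor (T x) _ _) (cong ((T x ∧ a x (suc j)) xor_) (sym (∧-assoc (T x) _ _)))) ⟩
      ⊕-sum (λ x → (T x ∧ a x (suc j)) xor ((T x ∧ a x zero) ∧ a s (suc j)))
        ≡⟨ ⊕-sum-xor (λ x → T x ∧ a x (suc j)) (λ x → (T x ∧ a x zero) ∧ a s (suc j)) ⟩
      ⊕-sum (λ x → T x ∧ a x (suc j)) xor ⊕-sum (λ x → (T x ∧ a x zero) ∧ a s (suc j))
        ≡⟨ cong (⊕-sum (λ x → T x ∧ a x (suc j)) xor_) (⊕-sum-∧ʳ (a s (suc j)) (λ x → T x ∧ a x zero)) ⟩
      ⊕-sum (λ x → T x ∧ a x (suc j)) xor (p ∧ a s (suc j))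
        ≡⟨ sym (sum-T* (λ x → a x (suc j))) ⟩
      ⊕-sum (λ x → T* x ∧ a x (suc j)) ∎
    result : ∃ λ j → ⊕-sum (λ x → T x ∧ (a x (suc j) xor (a x zero ∧ a s (suc j)))) ≡ true
    result with indep T* T*⊆S (x₀ , T*x₀)
    ... | zero  , sum≡1 with () ← trans (sym sum≡1) first-coordinate-vanishes
    ... | suc j , sum≡1 = j , trans (later-coordinate j) sum≡1

independent⇒size≤dim : ∀ r {n} (S : Fin n → Bool) (a : Fin n → Fin r → Bool) →
                       LinearlyIndependent S a → size S ≤ r
independent⇒size≤dim zero S a indep with any? (λ x → S x Bool.≟ true)
... | yes (x , Sx) with () ← proj₁ (indep S id (x , Sx))
... | no empty = ℕₚ.≤-reflexive (size-false (all-false empty))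
independent⇒size≤dim (suc r) S a indep with any? (λ x → (S x ∧ a x zero) Bool.≟ true)
... | no no-pivot =
  ℕₚ.m≤n⇒m≤1+n (independent⇒size≤dim r S _ (drop-zero-coordinate indep (all-false no-pivot)))
... | yes (s , pivot) = let Ss , as₀ = ∧-true pivot in
  ℕₚ.≤-trans (ℕₚ.≤-reflexive (size-remove S Ss))
             (s≤s (independent⇒size≤dim r (S -ᵇ s) _ (eliminate-pivot indep Ss as₀)))

∣∣≡size : ∀ {n} (S : Subset n) → ∣ S ∣ ≡ size (lookup S)
∣∣≡size []          = refl
∣∣≡size (true ∷ S)  = cong suc (∣∣≡size S)
∣∣≡size (false ∷ S) = ∣∣≡size S

rank⇒cut-rank : ∀ {n} (G : Graph n) (X : Subset n) {r} →
                RankAtMost G (_∈ X) (_∉ X) r → CutRankAtMost G X r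
rank⇒cut-rank {n} G X {r} (α , β , G≡αβ) S S⊆X independent-rows =
  subst (_≤ r) (sym (∣∣≡size S)) (independent⇒size≤dim r (lookup S) α independent)
  where
  independent : LinearlyIndependent (lookup S) α
  independent T T⊆S (x₀ , Tx₀) = j , proj₁ (∧-true sumⱼ≡1)
    where
    open ≡-Reasoning
    T′ : Subset n
    T′ = tabulate T
    T′≡T : ∀ x → lookup T′ x ≡ T x
    T′≡T = lookup∘tabulate T
    T′⊆S : T′ ⊆ S
    T′⊆S {x} x∈T′ = lookup⇒[]= x S (T⊆S (trans (sym (T′≡T x)) ([]=⇒lookup x∈T′)))
    witness : ∃ λ c → c ∉ X × ⊕-sum (λ x → lookup T′ x ∧ G x c) ≡ true
    witness = independent-rows T′ T′⊆S (x₀ , lookup⇒[]= x₀ T′ (trans (T′≡T x₀) Tx₀))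
    c : Fin n
    c = proj₁ witness
    c∉X : c ∉ X
    c∉X = proj₁ (proj₂ witness)
    row-of : ∀ x → lookup T′ x ∧ G x c ≡ ⊕-sum (λ j → (T x ∧ α x j) ∧ β j c)
    row-of x rewrite T′≡T x with T x in Tx
    ... | false = sym (⊕-sum-false {r} (λ _ → refl))
    ... | true  = G≡αβ (S⊆X (lookup⇒[]= x S (T⊆S Tx))) c∉X
    column-sum : ⊕-sum (λ x → lookup T′ x ∧ G x c) ≡ ⊕-sum (λ j → ⊕-sum (λ x → T x ∧ α x j) ∧ β j c)
    column-sum = begin
      ⊕-sum (λ x → lookup T′ x ∧ G x c)                  ≡⟨ ⊕-sum-cong row-of ⟩
      ⊕-sum (λ x → ⊕-sum (λ j → (T x ∧ α x j) ∧ β j c)) ≡⟨ ⊕-sum-comm (λ x j → (T x ∧ α x j) ∧ β j c) ⟩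
      ⊕-sum (λ j → ⊕-sum (λ x → (T x ∧ α x j) ∧ β j c)) ≡⟨ ⊕-sum-cong (λ j → ⊕-sum-∧ʳ (β j c) (λ x → T x ∧ α x j)) ⟩
      ⊕-sum (λ j → ⊕-sum (λ x → T x ∧ α x j) ∧ β j c)   ∎
    j-and-sum : ∃ λ j → ⊕-sum (λ x → T x ∧ α x j) ∧ β j c ≡ true
    j-and-sum = ⊕-sum≡true⇒∃ _ (trans (sym column-sum) (proj₂ (proj₂ witness)))
    j : Fin r
    j = proj₁ j-and-sum
    sumⱼ≡1 : ⊕-sum (λ x → T x ∧ α x j) ∧ β j c ≡ true
    sumⱼ≡1 = proj₂ j-and-sum

-- Local complementation and layouts

xor-cancelʳ : ∀ y x → y xor (x xor y) ≡ x
xor-cancelʳ y x = begin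
  y xor (x xor y) ≡⟨ cong (y xor_) (xor-comm x y) ⟩
  y xor (y xor x) ≡⟨ sym (xor-assoc y y x) ⟩
  (y xor y) xor x ≡⟨ cong (_xor x) (xor-same y) ⟩
  x               ∎
  where open ≡-Reasoning

xor-cancelˡ : ∀ y x → y xor (y xor x) ≡ x
xor-cancelˡ y x = trans (sym (xor-assoc y y x)) (cong (_xor x) (xor-same y))

separated : ∀ {A : Set} (pos : A → ℕ) {x c t} → pos x < t → t ≤ pos c → x ≢ c
separated pos x<t t≤c refl = ℕₚ.<⇒≱ x<t t≤c

Simple : ∀ {V : Set} → (V → V → Bool) → Set
Simple E = (∀ x y → E x y ≡ E y x) × (∀ x → E x x ≡ false)

record Layout {V : Set} (w : V) (N : ℕ) : Set where
  field
    pos : V → ℕ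
    pos-injective : ∀ {x y} → x ≢ w → y ≢ w → pos x ≡ pos y → x ≡ y
    pos-< : ∀ {x} → x ≢ w → pos x < N

  Before After : ℕ → V → Set
  Before t x = x ≢ w × pos x < t
  After  t x = x ≢ w × t ≤ pos x

record FullLayout {V : Set} (E : V → V → Bool) (N k : ℕ) : Set where
  field
    pos : V → ℕ
    pos-injective : ∀ {x y} → pos x ≡ pos y → x ≡ y
    pos-≤ : ∀ x → pos x ≤ N
    cut-rank : ∀ t → RankAtMost E (λ x → pos x < t) (λ c → t ≤ pos c) k

module Pivoting {V : Set} (_≟_ : DecidableEquality V) where

  open DecidableEquality⌊⌋ _≟_

  _✶ᵛ_ : (V → V → Bool) → V → V → V → Bool
  (E ✶ᵛ v) x y = E x y xor (E v x ∧ E v y ∧ not ⌊ x ≟ y ⌋)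

  open Layout using (Before; After)

  module _ (E : V → V → Bool) where

    DeletedWidth≤ : V → ℕ → ℕ → Set
    DeletedWidth≤ w N k =
      Σ (Layout w N) λ L → ∀ t → RankAtMost (E ✶ᵛ w) (Before L t) (After L t) k

    SharedWidth≤ : V → ℕ → ℕ → Set
    SharedWidth≤ w N k =
      Σ (Layout w N) λ L → ∀ t → RankAtMost (E ✶ᵛ w) (｛ w ｝ ∪ Before L t) (｛ w ｝ ∪ After L t) (suc k)

    PivotWidths≤ : ℕ → ℕ → Set
    PivotWidths≤ N k = ∀ w → DeletedWidth≤ w N k × SharedWidth≤ w N k

  ✶ᵛ-outside-row : ∀ {E w x c} → E w x ≡ false → (E ✶ᵛ w) x c ≡ E x c
  ✶ᵛ-outside-row {E} {x = x} {c} Ewx≡0 rewrite Ewx≡0 = xor-identityʳ (E x c)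

  ✶ᵛ-outside-column : ∀ {E w x c} → E w c ≡ false → (E ✶ᵛ w) x c ≡ E x c
  ✶ᵛ-outside-column {E} {w} {x} {c} Ewc≡0 rewrite Ewc≡0 | ∧-zeroʳ (E w x) = xor-identityʳ (E x c)

  _[_↦_] : (V → ℕ) → V → ℕ → V → ℕ
  (f [ w ↦ p ]) x with x ≟ w
  ... | yes _ = p
  ... | no _  = f x

  module _ {f : V → ℕ} {w : V} {p : ℕ} where

    ↦-here : (f [ w ↦ p ]) w ≡ p
    ↦-here with w ≟ w
    ... | yes _   = refl
    ... | no w≢w = contradiction refl w≢w

    ↦-there : ∀ {x} → x ≢ w → (f [ w ↦ p ]) x ≡ f x
    ↦-there {x} x≢w with x ≟ w
    ... | yes x≡w = contradiction x≡w x≢w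
    ... | no _    = refl

    ↦-injective : (∀ {x y} → x ≢ w → y ≢ w → f x ≡ f y → x ≡ y) → (∀ {x} → x ≢ w → f x ≢ p) →
                  ∀ {x y} → (f [ w ↦ p ]) x ≡ (f [ w ↦ p ]) y → x ≡ y
    ↦-injective f-inj f≢p {x} {y} eq = by-cases (x ≟ w) (y ≟ w)
      where
      by-cases : Dec (x ≡ w) → Dec (y ≡ w) → x ≡ y
      by-cases (yes x≡w)  (yes y≡w) = trans x≡w (sym y≡w)
      by-cases (yes refl) (no y≢w)  = contradiction (trans (sym (↦-there y≢w)) (trans (sym eq) ↦-here)) (f≢p y≢w)
      by-cases (no x≢w)   (yes refl) = contradiction (trans (sym (↦-there x≢w)) (trans eq ↦-here)) (f≢p x≢w)
      by-cases (no x≢w)   (no y≢w)  = f-inj x≢w y≢w (trans (sym (↦-there x≢w)) (trans eq (↦-there y≢w)))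

  module _ {E : V → V → Bool} (simple : Simple E) where

    private
      E-sym : ∀ x y → E x y ≡ E y x
      E-sym = proj₁ simple
      E-irr : ∀ x → E x x ≡ false
      E-irr = proj₂ simple

    E≡✶ᵛ : ∀ {w x c} → x ≢ c → E x c ≡ (E w x ∧ E w c) xor (E ✶ᵛ w) x c
    E≡✶ᵛ {w} {x} {c} x≢c rewrite ⌊≟⌋-≢ x≢c | ∧-identityʳ (E w c) = sym (xor-cancelʳ (E w x ∧ E w c) (E x c))

    -- Off the diagonal E = E * w + E w ⊗ E w, so putting w back at either end costs one rank.
    pivot-last : ∀ {w N k} → DeletedWidth≤ E w N k → Σ (FullLayout E N (suc k)) λ L → FullLayout.pos L w ≡ N
    pivot-last {w} {N} {k} (L , rank) = layout , ↦-here
      where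
      open Layout L
      pos′ : V → ℕ
      pos′ = pos [ w ↦ N ]
      pos′-≤ : ∀ x → pos′ x ≤ N
      pos′-≤ x with x ≟ w
      ... | yes _ = ℕₚ.≤-refl
      ... | no x≢w = ℕₚ.<⇒≤ (pos-< x≢w)
      entry : ∀ {x c} → x ≢ c → E x c ≡ (E w x ∧ (E w c xor ⌊ c ≟ w ⌋)) xor (not ⌊ c ≟ w ⌋ ∧ (E ✶ᵛ w) x c)
      entry {x} {c} x≢c with c ≟ w
      ... | yes refl rewrite E-irr c | ∧-identityʳ (E c x) = trans (E-sym x c) (sym (xor-identityʳ (E c x)))
      ... | no c≢w rewrite xor-identityʳ (E w c) = E≡✶ᵛ x≢c
      x≢w : ∀ {t x} → pos′ x < t → t ≤ N → x ≢ w
      x≢w x<t t≤N refl = ℕₚ.<⇒≱ x<t (subst (_ ≤_) (sym ↦-here) t≤N)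
      cut-rank : ∀ t → RankAtMost E (λ x → pos′ x < t) (λ c → t ≤ pos′ c) (suc k)
      cut-rank t with t ≤? N
      ... | no t≰N = rank-of-zero λ {x} {c} _ t≤c → contradiction (ℕₚ.≤-trans t≤c (pos′-≤ c)) t≰N
      ... | yes t≤N = rank-add-outer (E w) (λ c → E w c xor ⌊ c ≟ w ⌋) (λ x<t t≤c → entry (separated pos′ x<t t≤c))
        (rank-pullback {M = λ x c → not ⌊ c ≟ w ⌋ ∧ (E ✶ᵛ w) x c} id id (λ _ → true) (λ c → not ⌊ c ≟ w ⌋)
          (λ {x} x<t _ → let x≢w = x≢w x<t t≤N in x≢w , subst (_< t) (↦-there x≢w) x<t)
          (λ {c} t≤c c≢w → let c≢w = not⌊≟⌋⇒≢ c≢w in c≢w , subst (t ≤_) (↦-there c≢w) t≤c)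
          (λ _ _ → refl) (rank t))
      layout : FullLayout E N (suc k)
      layout = record { pos = pos′ ; pos-injective = ↦-injective pos-injective (λ x≢w → ℕₚ.<⇒≢ (pos-< x≢w))
                      ; pos-≤ = pos′-≤ ; cut-rank = cut-rank }

    pivot-first : ∀ {w N k} → DeletedWidth≤ E w N k → Σ (FullLayout E N (suc k)) λ L → FullLayout.pos L w ≡ 0
    pivot-first {w} {N} {k} (L , rank) = layout , ↦-here
      where
      open Layout L
      pos′ : V → ℕ
      pos′ = (suc ∘ pos) [ w ↦ 0 ]
      pos′-≤ : ∀ x → pos′ x ≤ N
      pos′-≤ x with x ≟ w
      ... | yes _ = z≤n
      ... | no x≢w = pos-< x≢w
      entry : ∀ {x c} → x ≢ c → E x c ≡ ((E w x xor ⌊ x ≟ w ⌋) ∧ E w c) xor (not ⌊ x ≟ w ⌋ ∧ (E ✶ᵛ w) x c)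
      entry {x} {c} x≢c with x ≟ w
      ... | yes refl rewrite E-irr x = sym (xor-identityʳ (E x c))
      ... | no x≢w rewrite xor-identityʳ (E w x) = E≡✶ᵛ x≢c
      c≢w : ∀ {s c} → suc s ≤ pos′ c → c ≢ w
      c≢w s<c refl with () ← subst (_ ≤_) ↦-here s<c
      cut-rank : ∀ t → RankAtMost E (λ x → pos′ x < t) (λ c → t ≤ pos′ c) (suc k)
      cut-rank zero    = rank-of-zero λ ()
      cut-rank (suc s) = rank-add-outer (λ x → E w x xor ⌊ x ≟ w ⌋) (E w) (λ x<t t≤c → entry (separated pos′ x<t t≤c))
        (rank-pullback {M = λ x c → not ⌊ x ≟ w ⌋ ∧ (E ✶ᵛ w) x c} id id (λ x → not ⌊ x ≟ w ⌋) (λ _ → true)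
          (λ {x} x<t x≢w → let x≢w = not⌊≟⌋⇒≢ x≢w in x≢w , ℕₚ.≤-pred (subst (_< suc s) (↦-there x≢w) x<t))
          (λ {c} t≤c _ → let c≢w = c≢w t≤c in c≢w , ℕₚ.≤-pred (subst (suc s ≤_) (↦-there c≢w) t≤c))
          (λ _ _ → refl) (rank s))
      layout : FullLayout E N (suc k)
      layout = record
        { pos = pos′
        ; pos-injective = ↦-injective (λ x≢w y≢w → pos-injective x≢w y≢w ∘ ℕₚ.suc-injective) (λ _ ())
        ; pos-≤ = pos′-≤ ; cut-rank = cut-rank }

module Transport {V V′ : Set} (_≟_ : DecidableEquality V) (_≟′_ : DecidableEquality V′)
  {E : V → V → Bool} {E′ : V′ → V′ → Bool}
  (φ : V → V′) (ψ : V′ → V) (ψ∘φ : ∀ x → ψ (φ x) ≡ x) (φ∘ψ : ∀ y → φ (ψ y) ≡ y)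
  (E′∘φ : ∀ x y → E′ (φ x) (φ y) ≡ E x y) where

  private
    module P  = Pivoting _≟_
    module P′ = Pivoting _≟′_

  E′≡E∘ψ : ∀ x y → E′ x y ≡ E (ψ x) (ψ y)
  E′≡E∘ψ x y = subst₂ (λ a b → E′ a b ≡ E (ψ x) (ψ y)) (φ∘ψ x) (φ∘ψ y) (E′∘φ (ψ x) (ψ y))

  ψ-injective : ∀ {x y} → ψ x ≡ ψ y → x ≡ y
  ψ-injective {x} {y} eq = trans (sym (φ∘ψ x)) (trans (cong φ eq) (φ∘ψ y))

  simple : Simple E → Simple E′
  simple (E-sym , E-irr) =
    (λ x y → trans (E′≡E∘ψ x y) (trans (E-sym (ψ x) (ψ y)) (sym (E′≡E∘ψ y x)))) ,
    (λ x → trans (E′≡E∘ψ x x) (E-irr (ψ x)))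

  module _ {v : V} where

    ✶≡ : ∀ x y → (E′ P′.✶ᵛ φ v) x y ≡ (E P.✶ᵛ v) (ψ x) (ψ y)
    ✶≡ x y rewrite E′≡E∘ψ x y | E′≡E∘ψ (φ v) x | E′≡E∘ψ (φ v) y | ψ∘φ v
                 | DecidableEquality⌊⌋.⌊≟⌋-injective _≟_ _≟′_ ψ-injective x y = refl

    ≢φ⇒ψ≢ : ∀ {x} → x ≢ φ v → ψ x ≢ v
    ≢φ⇒ψ≢ {x} x≢φv ψx≡v = x≢φv (trans (sym (φ∘ψ x)) (cong φ ψx≡v))

    layout : ∀ {N} → Layout v N → Layout (φ v) N
    layout L = record
      { pos = pos ∘ ψ
      ; pos-injective = λ x≢ y≢ eq → ψ-injective (pos-injective (≢φ⇒ψ≢ x≢) (≢φ⇒ψ≢ y≢) eq)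
      ; pos-< = pos-< ∘ ≢φ⇒ψ≢ }
      where open Layout L

    deleted : ∀ {N k} → P.DeletedWidth≤ E v N k → P′.DeletedWidth≤ E′ (φ v) N k
    deleted (L , rank) = layout L , λ t →
      rank-pullback ψ ψ (λ _ → true) (λ _ → true)
        (λ (x≢ , x<t) _ → ≢φ⇒ψ≢ x≢ , x<t) (λ (c≢ , t≤c) _ → ≢φ⇒ψ≢ c≢ , t≤c)
        (λ {x} {c} _ _ → ✶≡ x c) (rank t)

    shared : ∀ {N k} → P.SharedWidth≤ E v N k → P′.SharedWidth≤ E′ (φ v) N k
    shared (L , rank) = layout L , λ t →
      rank-pullback ψ ψ (λ _ → true) (λ _ → true)
        (λ x∈ _ → pull {P = λ y → pos y < t} x∈) (λ c∈ _ → pull {P = λ y → t ≤ pos y} c∈)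
        (λ {x} {c} _ _ → ✶≡ x c) (rank t)
      where
      pull : ∀ {x} {P : V → Set} → φ v ≡ x ⊎ (x ≢ φ v × P (ψ x)) → v ≡ ψ x ⊎ (ψ x ≢ v × P (ψ x))
      pull = Sum.map (λ φv≡x → trans (sym (ψ∘φ v)) (cong ψ φv≡x)) (Product.map₁ ≢φ⇒ψ≢)
      open Layout L

  pivot-widths : ∀ {N k} → P.PivotWidths≤ E N k → P′.PivotWidths≤ E′ N k
  pivot-widths {N} {k} widths w =
    subst (λ w → P′.DeletedWidth≤ E′ w N k × P′.SharedWidth≤ E′ w N k) (φ∘ψ w)
          (Product.map deleted shared (widths (ψ w)))

module Pivotingᶠ {n : ℕ} = Pivoting (_≟_ {n})
open Pivotingᶠ using (PivotWidths≤)

-- Delta compositions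

module _ {a b c : ℕ} where

  ⟨_,_,_⟩ : ∀ {ℓ} {A : Set ℓ} → (Fin a → A) → (Fin b → A) → (Fin c → A) → Part a b c → A
  ⟨ f₁ , f₂ , f₃ ⟩ (p₁ x) = f₁ x
  ⟨ f₁ , f₂ , f₃ ⟩ (p₂ y) = f₂ y
  ⟨ f₁ , f₂ , f₃ ⟩ (p₃ z) = f₃ z

  p₁-injective : ∀ {x y : Fin a} → p₁ {b = b} {c = c} x ≡ p₁ y → x ≡ y
  p₁-injective refl = refl

  p₂-injective : ∀ {x y : Fin b} → p₂ {a = a} {c = c} x ≡ p₂ y → x ≡ y
  p₂-injective refl = refl

  p₃-injective : ∀ {x y : Fin c} → p₃ {a = a} {b = b} x ≡ p₃ y → x ≡ y
  p₃-injective refl = refl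

  _≟ₚ_ : DecidableEquality (Part a b c)
  p₁ x ≟ₚ p₁ y = map′ (cong p₁) p₁-injective (x ≟ y)
  p₂ x ≟ₚ p₂ y = map′ (cong p₂) p₂-injective (x ≟ y)
  p₃ x ≟ₚ p₃ y = map′ (cong p₃) p₃-injective (x ≟ y)
  p₁ _ ≟ₚ p₂ _ = no λ ()
  p₁ _ ≟ₚ p₃ _ = no λ ()
  p₂ _ ≟ₚ p₁ _ = no λ ()
  p₂ _ ≟ₚ p₃ _ = no λ ()
  p₃ _ ≟ₚ p₁ _ = no λ ()
  p₃ _ ≟ₚ p₂ _ = no λ ()

  ⌊p₁≟p₁⌋ : ∀ x y → ⌊ x ≟ y ⌋ ≡ ⌊ p₁ x ≟ₚ p₁ y ⌋
  ⌊p₁≟p₁⌋ = DecidableEquality⌊⌋.⌊≟⌋-injective _≟ₚ_ _≟_ p₁-injective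

composeAdj-simple : ∀ {a b c} {G₁ : Graph a} {G₂ : Graph b} {G₃ : Graph c} v₁ v₂ v₃ →
                    Simple G₁ → Simple G₂ → Simple G₃ → Simple (composeAdj G₁ G₂ G₃ v₁ v₂ v₃)
composeAdj-simple v₁ v₂ v₃ (sym₁ , irr₁) (sym₂ , irr₂) (sym₃ , irr₃) =
  symmetric , λ { (p₁ x) → irr₁ x ; (p₂ y) → irr₂ y ; (p₃ z) → irr₃ z }
  where
  symmetric : ∀ x y → composeAdj _ _ _ v₁ v₂ v₃ x y ≡ composeAdj _ _ _ v₁ v₂ v₃ y x
  symmetric (p₁ x) (p₁ y) = sym₁ x y
  symmetric (p₂ x) (p₂ y) = sym₂ x y
  symmetric (p₃ x) (p₃ y) = sym₃ x y
  symmetric (p₁ x) (p₂ y) = ∧-comm (x == v₁) (y == v₂)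
  symmetric (p₁ x) (p₃ y) = ∧-comm (x == v₁) (y == v₃)
  symmetric (p₂ x) (p₁ y) = ∧-comm (x == v₂) (y == v₁)
  symmetric (p₂ x) (p₃ y) = ∧-comm (x == v₂) (y == v₃)
  symmetric (p₃ x) (p₁ y) = ∧-comm (x == v₃) (y == v₁)
  symmetric (p₃ x) (p₂ y) = ∧-comm (x == v₃) (y == v₂)

module Composition {a′ b′ c′ : ℕ} {G₁ : Graph (suc a′)} {G₂ : Graph (suc b′)} {G₃ : Graph (suc c′)}
  (v₁ : Fin (suc a′)) (v₂ : Fin (suc b′)) (v₃ : Fin (suc c′)) where

  open Pivoting (_≟ₚ_ {suc a′} {suc b′} {suc c′})
  open Fin⌊≟⌋

  P : Set
  P = Part (suc a′) (suc b′) (suc c′)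

  D : P → P → Bool
  D = composeAdj G₁ G₂ G₃ v₁ v₂ v₃

  N : ℕ
  N = suc b′ + (a′ + suc c′)

  module _ {k} (L₂ : FullLayout G₂ b′ k) (v₂-last : FullLayout.pos L₂ v₂ ≡ b′) (u : Fin (suc a′)) where
    open FullLayout L₂

    region-G₂ : ∀ {t} → t ≤ b′ →
      RankAtMost (D ✶ᵛ p₁ u) ⟨ ∅ , (λ y → pos y < t) , ∅ ⟩ ⟨ U , (λ z → t ≤ pos z) , U ⟩ k
    region-G₂ {t} t≤b′ =
      rank-pullback from₂ from₂ (λ _ → true) ⟨ (λ _ → false) , (λ _ → true) , (λ _ → false) ⟩
        (λ { {p₁ _} () ; {p₂ y} y<t _ → y<t ; {p₃ _} () })
        (λ { {p₁ _} _ () ; {p₂ z} t≤z _ → t≤z ; {p₃ _} _ () })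
        (λ {x} {c} → entry {x} {c}) (cut-rank t)
      where
      from₂ : P → Fin (suc b′)
      from₂ = ⟨ (λ _ → v₂) , id , (λ _ → v₂) ⟩
      entry : ∀ {x c} → ⟨ ∅ , (λ y → pos y < t) , ∅ ⟩ x → ⟨ U , (λ z → t ≤ pos z) , U ⟩ c →
              (D ✶ᵛ p₁ u) x c ≡ ⟨ (λ _ → false) , (λ _ → true) , (λ _ → false) ⟩ c ∧ G₂ (from₂ x) (from₂ c)
      entry {p₂ y} {c} y<t _ =
        trans (✶ᵛ-outside-row {D} {p₁ u} {p₂ y} {c} (trans (cong ((u == v₁) ∧_) y≠v₂) (∧-zeroʳ (u == v₁)))) (row c)
        where
        y≠v₂ : (y == v₂) ≡ false
        y≠v₂ = ⌊≟⌋-≢ λ { refl → ℕₚ.<⇒≱ y<t (subst (t ≤_) (sym v₂-last) t≤b′) }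
        row : ∀ c → D (p₂ y) c ≡ ⟨ (λ _ → false) , (λ _ → true) , (λ _ → false) ⟩ c ∧ G₂ y (from₂ c)
        row (p₁ x) rewrite y≠v₂ = refl
        row (p₂ z) = refl
        row (p₃ z) rewrite y≠v₂ = refl

  module _ {k} (L₃ : FullLayout G₃ c′ k) (v₃-first : FullLayout.pos L₃ v₃ ≡ 0) (u : Fin (suc a′)) where
    open FullLayout L₃

    region-G₃ : ∀ s →
      RankAtMost (D ✶ᵛ p₁ u) ⟨ U , U , (λ z → pos z < suc s) ⟩ ⟨ ∅ , ∅ , (λ z → suc s ≤ pos z) ⟩ k
    region-G₃ s =
      rank-pullback from₃ from₃ ⟨ (λ _ → false) , (λ _ → false) , (λ _ → true) ⟩ (λ _ → true)
        (λ { {p₁ _} _ () ; {p₂ _} _ () ; {p₃ z} z<t _ → z<t })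
        (λ { {p₁ _} () ; {p₂ _} () ; {p₃ z} t≤z _ → t≤z })
        (λ {x} {c} → entry {x} {c}) (cut-rank (suc s))
      where
      from₃ : P → Fin (suc c′)
      from₃ = ⟨ (λ _ → v₃) , (λ _ → v₃) , id ⟩
      entry : ∀ {x c} → ⟨ U , U , (λ z → pos z < suc s) ⟩ x → ⟨ ∅ , ∅ , (λ z → suc s ≤ pos z) ⟩ c →
              (D ✶ᵛ p₁ u) x c ≡ ⟨ (λ _ → false) , (λ _ → false) , (λ _ → true) ⟩ x ∧ G₃ (from₃ x) (from₃ c)
      entry {x} {p₃ z} _ s<z =
        trans (✶ᵛ-outside-column {D} {p₁ u} {x} {p₃ z} (trans (cong ((u == v₁) ∧_) z≠v₃) (∧-zeroʳ (u == v₁)))) (column x)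
        where
        z≠v₃ : (z == v₃) ≡ false
        z≠v₃ = ⌊≟⌋-≢ λ { refl → ℕₚ.<⇒≱ (s≤s z≤n) (subst (suc s ≤_) v₃-first s<z) }
        column : ∀ x → D x (p₃ z) ≡ ⟨ (λ _ → false) , (λ _ → false) , (λ _ → true) ⟩ x ∧ G₃ (from₃ x) z
        column (p₁ x) rewrite z≠v₃ = ∧-zeroʳ (x == v₁)
        column (p₂ y) rewrite z≠v₃ = ∧-zeroʳ (y == v₂)
        column (p₃ z′) = refl

  module _ (u : Fin (suc a′)) (u≢v₁ : u ≢ v₁) {R₁ C₁ : Fin (suc a′) → Set} {r : ℕ}
    (v₁-not-on-both-sides : ∀ {x x′} → R₁ x → C₁ x′ → x ≡ v₁ → x′ ≢ v₁) where

    -- the triangle edges across the cut form the rank-one matrix [v₁, v₂] ⊗ [v₁, v₃]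
    region-G₁ : RankAtMost (G₁ ✶ u) R₁ C₁ r →
                RankAtMost (D ✶ᵛ p₁ u) ⟨ R₁ , U , ∅ ⟩ ⟨ C₁ , ∅ , U ⟩ (suc r)
    region-G₁ rank =
      rank-add-outer ⟨ (_== v₁) , (_== v₂) , (λ _ → false) ⟩ ⟨ (_== v₁) , (λ _ → false) , (_== v₃) ⟩
        (λ {x} {c} → entry {x} {c})
        (rank-pullback from₁ from₁ is₁ is₁ (λ { {p₁ _} x∈R₁ _ → x∈R₁ }) (λ { {p₁ _} c∈C₁ _ → c∈C₁ })
           (λ _ _ → refl) rank)
      where
      from₁ : P → Fin (suc a′)
      from₁ = ⟨ id , (λ _ → u) , (λ _ → u) ⟩
      is₁ : P → Bool
      is₁ = ⟨ (λ _ → true) , (λ _ → false) , (λ _ → false) ⟩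
      u≠v₁ : (u == v₁) ≡ false
      u≠v₁ = ⌊≟⌋-≢ u≢v₁
      entry : ∀ {x c} → ⟨ R₁ , U , ∅ ⟩ x → ⟨ C₁ , ∅ , U ⟩ c →
              (D ✶ᵛ p₁ u) x c ≡ (⟨ (_== v₁) , (_== v₂) , (λ _ → false) ⟩ x ∧ ⟨ (_== v₁) , (λ _ → false) , (_== v₃) ⟩ c)
                                xor (is₁ x ∧ is₁ c ∧ (G₁ ✶ u) (from₁ x) (from₁ c))
      entry {p₁ x} {p₁ x′} x∈R₁ x′∈C₁ rewrite sym (⌊p₁≟p₁⌋ {b = suc b′} {c = suc c′} x x′) with x == v₁ in x≡v₁
      ... | false = refl
      ... | true rewrite ⌊≟⌋-≢ (v₁-not-on-both-sides x∈R₁ x′∈C₁ (⌊≟⌋⇒≡ x≡v₁)) = refl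
      entry {p₁ x} {p₃ z} _ _ rewrite u≠v₁ | ∧-zeroʳ (G₁ u x) = refl
      entry {p₂ y} {p₁ x′} _ _ rewrite u≠v₁ = refl
      entry {p₂ y} {p₃ z} _ _ rewrite u≠v₁ = refl

  module _ (simple₁ : Simple G₁) {R₁ C₁ : Fin (suc a′) → Set} {r : ℕ}
    (R₁∌v₁ : ∀ {x} → R₁ x → x ≢ v₁) (C₁∌v₁ : ∀ {x} → C₁ x → x ≢ v₁) where

    private
      sym₁ : ∀ x y → G₁ x y ≡ G₁ y x
      sym₁ = proj₁ simple₁
      irr₁ : ∀ x → G₁ x x ≡ false
      irr₁ = proj₂ simple₁

    -- Complementing at v₁ makes v₂ and v₃ copies of the row and the column of v₁ in G₁ * v₁.
    region-G₁-at-v₁ : RankAtMost (G₁ ✶ v₁) (｛ v₁ ｝ ∪ R₁) (｛ v₁ ｝ ∪ C₁) r →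
                      RankAtMost (D ✶ᵛ p₁ v₁) ⟨ R₁ , U , ∅ ⟩ ⟨ C₁ , ∅ , U ⟩ r
    region-G₁-at-v₁ =
      rank-pullback from₁ from₁ ⟨ (λ _ → true) , (_== v₂) , (λ _ → false) ⟩ ⟨ (λ _ → true) , (λ _ → false) , (_== v₃) ⟩
        (λ { {p₁ _} x∈R₁ _ → inj₂ x∈R₁ ; {p₂ _} _ _ → inj₁ refl })
        (λ { {p₁ _} c∈C₁ _ → inj₂ c∈C₁ ; {p₃ _} _ _ → inj₁ refl })
        (λ {x} {c} → entry {x} {c})
      where
      from₁ : P → Fin (suc a′)
      from₁ = ⟨ id , (λ _ → v₁) , (λ _ → v₁) ⟩
      entry : ∀ {x c} → ⟨ R₁ , U , ∅ ⟩ x → ⟨ C₁ , ∅ , U ⟩ c →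
              (D ✶ᵛ p₁ v₁) x c ≡ ⟨ (λ _ → true) , (_== v₂) , (λ _ → false) ⟩ x ∧ ⟨ (λ _ → true) , (λ _ → false) , (_== v₃) ⟩ c
                                 ∧ (G₁ ✶ v₁) (from₁ x) (from₁ c)
      entry {p₁ x} {p₁ x′} _ _ rewrite sym (⌊p₁≟p₁⌋ {b = suc b′} {c = suc c′} x x′) = refl
      entry {p₁ x} {p₃ z} x∈R₁ _
        rewrite ⌊≟⌋-≢ (R₁∌v₁ x∈R₁) | ⌊≟⌋-refl v₁ | irr₁ v₁ | ∧-zeroʳ (G₁ v₁ x) | ∧-identityʳ (z == v₃)
              | xor-identityʳ (G₁ x v₁) = trans (∧-comm (G₁ v₁ x) (z == v₃)) (cong ((z == v₃) ∧_) (sym₁ v₁ x))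
      entry {p₂ y} {p₁ x′} _ x′∈C₁
        rewrite ⌊≟⌋-≢ (C₁∌v₁ x′∈C₁) | ⌊≟⌋-refl v₁ | irr₁ v₁ | ∧-zeroʳ (y == v₂) | ∧-identityʳ (G₁ v₁ x′)
              | xor-identityʳ (G₁ v₁ x′) = refl
      entry {p₂ y} {p₃ z} _ _
        rewrite ⌊≟⌋-refl v₁ | irr₁ v₁ | ∧-identityʳ (z == v₃) | xor-same ((y == v₂) ∧ (z == v₃))
              | ∧-zeroʳ (z == v₃) | ∧-zeroʳ (y == v₂) = refl

    -- Rows v₁ and v₂ of D * v₁ are g + e₃ and g + e₁, where g is the row of v₁ in G₁ and eᵢ is the
    -- unit vector of vᵢ, while any other row x gains g(x) (e₁ + e₃); so two extra vectors suffice.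
    region-G₁-at-v₁-shared : RankAtMost (G₁ ✶ v₁) R₁ C₁ r →
      RankAtMost (D ✶ᵛ p₁ v₁) ⟨ ｛ v₁ ｝ ∪ R₁ , U , ∅ ⟩ ⟨ ｛ v₁ ｝ ∪ C₁ , ∅ , U ⟩ (suc (suc r))
    region-G₁-at-v₁-shared rank =
      rank-add-outer a₃ b₃ (λ {x} {c} → entry {x} {c})
        (rank-add-outer {M = λ x c → (a₁ x ∧ b₁ c) xor M₀ x c} a₁ b₁ (λ _ _ → refl)
          (rank-pullback {M = M₀} from₁ from₁ off-v₁ off-v₁ (λ {x} → rows {x}) (λ {c} → cols {c}) (λ _ _ → refl) rank))
      where
      g : Fin (suc a′) → Bool
      g = G₁ v₁
      from₁ : P → Fin (suc a′)
      from₁ = ⟨ id , (λ _ → v₁) , (λ _ → v₁) ⟩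
      a₁ : P → Bool
      a₁ = ⟨ g , (_== v₂) , (λ _ → false) ⟩
      b₁ : P → Bool
      b₁ = ⟨ (λ x → g x xor (x == v₁)) , (λ _ → false) , (λ _ → false) ⟩
      a₃ : P → Bool
      a₃ = ⟨ (λ x → g x xor (x == v₁)) , (λ _ → false) , (λ _ → false) ⟩
      b₃ : P → Bool
      b₃ = ⟨ g , (λ _ → false) , (_== v₃) ⟩
      off-v₁ : P → Bool
      off-v₁ = ⟨ (λ x → not (x == v₁)) , (λ _ → false) , (λ _ → false) ⟩
      M₀ : P → P → Bool
      M₀ x c = off-v₁ x ∧ off-v₁ c ∧ (G₁ ✶ v₁) (from₁ x) (from₁ c)
      rows : ∀ {x} → ⟨ ｛ v₁ ｝ ∪ R₁ , U , ∅ ⟩ x → off-v₁ x ≡ true → R₁ (from₁ x)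
      rows {p₁ _} (inj₁ refl) x≢v₁ = contradiction refl (not⌊≟⌋⇒≢ x≢v₁)
      rows {p₁ _} (inj₂ x∈R₁) _    = x∈R₁
      cols : ∀ {c} → ⟨ ｛ v₁ ｝ ∪ C₁ , ∅ , U ⟩ c → off-v₁ c ≡ true → C₁ (from₁ c)
      cols {p₁ _} (inj₁ refl) c≢v₁ = contradiction refl (not⌊≟⌋⇒≢ c≢v₁)
      cols {p₁ _} (inj₂ c∈C₁) _    = c∈C₁
      entry : ∀ {x c} → ⟨ ｛ v₁ ｝ ∪ R₁ , U , ∅ ⟩ x → ⟨ ｛ v₁ ｝ ∪ C₁ , ∅ , U ⟩ c →
              (D ✶ᵛ p₁ v₁) x c ≡ (a₃ x ∧ b₃ c) xor ((a₁ x ∧ b₁ c) xor M₀ x c)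
      entry {p₁ _} {p₁ _} (inj₁ refl) (inj₁ refl)
        rewrite sym (⌊p₁≟p₁⌋ {b = suc b′} {c = suc c′} v₁ v₁) | ⌊≟⌋-refl v₁ | irr₁ v₁ = refl
      entry {p₁ _} {p₁ x′} (inj₁ refl) (inj₂ x′∈C₁)
        rewrite ⌊≟⌋-refl v₁ | irr₁ v₁ = refl
      entry {p₁ _} {p₃ z} (inj₁ refl) _
        rewrite ⌊≟⌋-refl v₁ | irr₁ v₁ = refl
      entry {p₁ x} {p₁ _} (inj₂ x∈R₁) (inj₁ refl)
        rewrite ⌊≟⌋-refl v₁ | ⌊≟⌋-≢ (R₁∌v₁ x∈R₁) | irr₁ v₁ | xor-identityʳ (G₁ v₁ x) | ∧-zeroʳ (G₁ v₁ x)
              | ∧-identityʳ (G₁ v₁ x) | xor-identityʳ (G₁ x v₁) | xor-identityʳ (G₁ v₁ x) = sym₁ x v₁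
      entry {p₁ x} {p₁ x′} (inj₂ x∈R₁) (inj₂ x′∈C₁)
        rewrite sym (⌊p₁≟p₁⌋ {b = suc b′} {c = suc c′} x x′) | ⌊≟⌋-≢ (R₁∌v₁ x∈R₁) | ⌊≟⌋-≢ (C₁∌v₁ x′∈C₁)
              | xor-identityʳ (G₁ v₁ x) | xor-identityʳ (G₁ v₁ x′) =
        sym (xor-cancelˡ (G₁ v₁ x ∧ G₁ v₁ x′) _)
      entry {p₁ x} {p₃ z} (inj₂ x∈R₁) _
        rewrite ⌊≟⌋-refl v₁ | ⌊≟⌋-≢ (R₁∌v₁ x∈R₁) | ∧-identityʳ (z == v₃) | xor-identityʳ (G₁ v₁ x)
              | ∧-zeroʳ (G₁ v₁ x) | xor-identityʳ (G₁ v₁ x ∧ (z == v₃)) = refl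
      entry {p₂ y} {p₁ _} _ (inj₁ refl)
        rewrite ⌊≟⌋-refl v₁ | irr₁ v₁ | ∧-identityʳ (y == v₂) | ∧-zeroʳ (y == v₂) = refl
      entry {p₂ y} {p₁ x′} _ (inj₂ x′∈C₁)
        rewrite ⌊≟⌋-refl v₁ | ⌊≟⌋-≢ (C₁∌v₁ x′∈C₁) | ∧-zeroʳ (y == v₂) | ∧-identityʳ (G₁ v₁ x′)
              | xor-identityʳ (G₁ v₁ x′) | xor-identityʳ ((y == v₂) ∧ G₁ v₁ x′) = refl
      entry {p₂ y} {p₃ z} _ _
        rewrite ⌊≟⌋-refl v₁ | ∧-identityʳ (z == v₃) | xor-same ((y == v₂) ∧ (z == v₃)) | ∧-zeroʳ (y == v₂) = refl

  data Cut : ℕ → Set where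
    inside-G₂ : ∀ {t} → t ≤ b′ → Cut t
    inside-G₁ : ∀ {s} → s ≤ a′ → Cut (suc b′ + s)
    inside-G₃ : ∀ s → Cut (suc b′ + (a′ + suc s))

  cut? : ∀ t → Cut t
  cut? t with t ≤? b′
  ... | yes t≤b′ = inside-G₂ t≤b′
  ... | no t≰b′ with ℕₚ.m≤n⇒∃[o]m+o≡n (ℕₚ.≰⇒> t≰b′)
  ...   | s , refl with s ≤? a′
  ...     | yes s≤a′ = inside-G₁ s≤a′
  ...     | no s≰a′ with ℕₚ.m≤n⇒∃[o]m+o≡n (ℕₚ.≰⇒> s≰a′)
  ...       | o , refl rewrite sym (ℕₚ.+-suc a′ o) = inside-G₃ o

  module Concatenation {u : Fin (suc a′)} {k : ℕ}
    (L₁ : Layout u a′)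
    (L₂ : FullLayout G₂ b′ (suc k)) (v₂-last : FullLayout.pos L₂ v₂ ≡ b′)
    (L₃ : FullLayout G₃ c′ (suc k)) (v₃-first : FullLayout.pos L₃ v₃ ≡ 0) where

    open Layout L₁
      renaming (pos to pos₁; pos-injective to pos₁-injective; pos-< to pos₁-<; Before to Before₁; After to After₁)
    open FullLayout L₂ renaming (pos to pos₂; pos-injective to pos₂-injective; pos-≤ to pos₂-≤)
    open FullLayout L₃ renaming (pos to pos₃; pos-injective to pos₃-injective; pos-≤ to pos₃-≤)

    pos : P → ℕ
    pos = ⟨ (λ x → suc b′ + pos₁ x) , pos₂ , (λ z → suc b′ + (a′ + pos₃ z)) ⟩

    ≢p₁ : ∀ {x} → p₁ {b = suc b′} {c = suc c′} x ≢ p₁ u → x ≢ u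
    ≢p₁ x≢ = x≢ ∘ cong p₁

    G₂-first : ∀ y m → pos₂ y < suc b′ + m
    G₂-first y m = s≤s (ℕₚ.≤-trans (pos₂-≤ y) (ℕₚ.m≤m+n b′ m))

    G₁-before-G₃ : ∀ {x} → x ≢ u → ∀ m → pos₁ x < a′ + m
    G₁-before-G₃ x≢u m = ℕₚ.<-≤-trans (pos₁-< x≢u) (ℕₚ.m≤m+n a′ m)

    layout : Layout (p₁ u) N
    layout = record { pos = pos ; pos-injective = injective ; pos-< = bounded }
      where
      injective : ∀ {x y} → x ≢ p₁ u → y ≢ p₁ u → pos x ≡ pos y → x ≡ y
      injective {p₁ x} {p₁ y} x≢ y≢ eq = cong p₁ (pos₁-injective (≢p₁ x≢) (≢p₁ y≢) (ℕₚ.+-cancelˡ-≡ (suc b′) _ _ eq))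
      injective {p₂ x} {p₂ y} _ _ eq = cong p₂ (pos₂-injective eq)
      injective {p₃ x} {p₃ y} _ _ eq =
        cong p₃ (pos₃-injective (ℕₚ.+-cancelˡ-≡ a′ _ _ (ℕₚ.+-cancelˡ-≡ (suc b′) _ _ eq)))
      injective {p₂ y} {p₁ _} _ _ eq = contradiction eq (ℕₚ.<⇒≢ (G₂-first y _))
      injective {p₂ y} {p₃ _} _ _ eq = contradiction eq (ℕₚ.<⇒≢ (G₂-first y _))
      injective {p₁ _} {p₂ y} _ _ eq = contradiction (sym eq) (ℕₚ.<⇒≢ (G₂-first y _))
      injective {p₃ _} {p₂ y} _ _ eq = contradiction (sym eq) (ℕₚ.<⇒≢ (G₂-first y _))
      injective {p₁ x} {p₃ z} x≢ _ eq =
        contradiction (ℕₚ.+-cancelˡ-≡ (suc b′) _ _ eq) (ℕₚ.<⇒≢ (G₁-before-G₃ (≢p₁ x≢) (pos₃ z)))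
      injective {p₃ z} {p₁ x} _ x≢ eq =
        contradiction (ℕₚ.+-cancelˡ-≡ (suc b′) _ _ (sym eq)) (ℕₚ.<⇒≢ (G₁-before-G₃ (≢p₁ x≢) (pos₃ z)))
      bounded : ∀ {x} → x ≢ p₁ u → pos x < N
      bounded {p₁ x} x≢ = ℕₚ.+-monoʳ-< (suc b′) (G₁-before-G₃ (≢p₁ x≢) (suc c′))
      bounded {p₂ y} _  = G₂-first y _
      bounded {p₃ z} _  = ℕₚ.+-monoʳ-< (suc b′) (ℕₚ.+-monoʳ-< a′ (s≤s (pos₃-≤ z)))

    open Layout layout using (Before; After)

    beyond-G₂ : ∀ m {t} → t ≤ b′ → ¬ (suc b′ + m < t)
    beyond-G₂ m t≤b′ lt = ℕₚ.<⇒≱ (ℕₚ.<-≤-trans lt t≤b′) (ℕₚ.≤-trans (ℕₚ.n≤1+n b′) (ℕₚ.m≤m+n (suc b′) m))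

    before-in-G₂ : ∀ {t} → t ≤ b′ → ∀ {x} → Before t x → ⟨ ∅ , (λ y → pos₂ y < t) , ∅ ⟩ x
    before-in-G₂ t≤b′ {p₁ x} (_ , lt) = beyond-G₂ (pos₁ x) t≤b′ lt
    before-in-G₂ t≤b′ {p₂ y} (_ , lt) = lt
    before-in-G₂ t≤b′ {p₃ z} (_ , lt) = beyond-G₂ (a′ + pos₃ z) t≤b′ lt

    after-in-G₂ : ∀ {t c} → After t c → ⟨ U , (λ z → t ≤ pos₂ z) , U ⟩ c
    after-in-G₂ {c = p₁ _} _        = tt
    after-in-G₂ {c = p₂ _} (_ , le) = le
    after-in-G₂ {c = p₃ _} _        = tt

    before-in-G₁ : ∀ {s} → s ≤ a′ → ∀ {x} → Before (suc b′ + s) x → ⟨ Before₁ s , U , ∅ ⟩ x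
    before-in-G₁ s≤a′ {p₁ x} (x≢ , lt) = ≢p₁ x≢ , ℕₚ.+-cancelˡ-< (suc b′) _ _ lt
    before-in-G₁ s≤a′ {p₂ y} _         = tt
    before-in-G₁ s≤a′ {p₃ z} (_ , lt)  =
      ℕₚ.<⇒≱ (ℕₚ.+-cancelˡ-< (suc b′) _ _ lt) (ℕₚ.≤-trans s≤a′ (ℕₚ.m≤m+n a′ (pos₃ z)))

    after-in-G₁ : ∀ {s c} → After (suc b′ + s) c → ⟨ After₁ s , ∅ , U ⟩ c
    after-in-G₁ {c = p₁ x} (x≢ , le) = ≢p₁ x≢ , ℕₚ.+-cancelˡ-≤ (suc b′) _ _ le
    after-in-G₁ {c = p₂ y} (_ , le)  = ℕₚ.<⇒≱ (G₂-first y _) le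
    after-in-G₁ {c = p₃ z} _         = tt

    before-in-G₃ : ∀ {s x} → Before (suc b′ + (a′ + suc s)) x → ⟨ U , U , (λ z → pos₃ z < suc s) ⟩ x
    before-in-G₃ {x = p₁ _} _        = tt
    before-in-G₃ {x = p₂ _} _        = tt
    before-in-G₃ {x = p₃ z} (_ , lt) = ℕₚ.+-cancelˡ-< a′ _ _ (ℕₚ.+-cancelˡ-< (suc b′) _ _ lt)

    after-in-G₃ : ∀ {s c} → After (suc b′ + (a′ + suc s)) c → ⟨ ∅ , ∅ , (λ z → suc s ≤ pos₃ z) ⟩ c
    after-in-G₃ {s} {p₁ x} (x≢ , le) = ℕₚ.<⇒≱ (G₁-before-G₃ (≢p₁ x≢) (suc s)) (ℕₚ.+-cancelˡ-≤ (suc b′) _ _ le)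
    after-in-G₃ {c = p₂ y} (_ , le)  = ℕₚ.<⇒≱ (G₂-first y _) le
    after-in-G₃ {c = p₃ z} (_ , le)  = ℕₚ.+-cancelˡ-≤ a′ _ _ (ℕₚ.+-cancelˡ-≤ (suc b′) _ _ le)

    shared-before-in-G₁ : ∀ {s} → s ≤ a′ → ∀ {x} → (｛ p₁ u ｝ ∪ Before (suc b′ + s)) x →
                          ⟨ ｛ u ｝ ∪ Before₁ s , U , ∅ ⟩ x
    shared-before-in-G₁ s≤a′ (inj₁ refl)       = inj₁ refl
    shared-before-in-G₁ s≤a′ {p₁ x} (inj₂ x∈) = inj₂ (before-in-G₁ s≤a′ x∈)
    shared-before-in-G₁ s≤a′ {p₂ y} (inj₂ x∈) = tt
    shared-before-in-G₁ s≤a′ {p₃ z} (inj₂ x∈) = before-in-G₁ s≤a′ x∈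

    shared-after-in-G₁ : ∀ {s c} → (｛ p₁ u ｝ ∪ After (suc b′ + s)) c → ⟨ ｛ u ｝ ∪ After₁ s , ∅ , U ⟩ c
    shared-after-in-G₁ (inj₁ refl)             = inj₁ refl
    shared-after-in-G₁ {c = p₁ x} (inj₂ c∈)  = inj₂ (after-in-G₁ c∈)
    shared-after-in-G₁ {c = p₂ y} (inj₂ c∈)  = after-in-G₁ c∈
    shared-after-in-G₁ {c = p₃ z} (inj₂ c∈)  = tt

    deleted : (∀ s → RankAtMost (D ✶ᵛ p₁ u) ⟨ Before₁ s , U , ∅ ⟩ ⟨ After₁ s , ∅ , U ⟩ (suc k)) →
              DeletedWidth≤ D (p₁ u) N (suc k)
    deleted region₁ = layout , cut
      where
      cut : ∀ t → RankAtMost (D ✶ᵛ p₁ u) (Before t) (After t) (suc k)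
      cut t with cut? t
      ... | inside-G₂ t≤b′ = rank-restrict (λ {x} → before-in-G₂ t≤b′ {x}) (λ {c} → after-in-G₂ {c = c})
                               (region-G₂ L₂ v₂-last u t≤b′)
      ... | inside-G₁ s≤a′ = rank-restrict (λ {x} → before-in-G₁ s≤a′ {x}) (λ {c} → after-in-G₁ {c = c}) (region₁ _)
      ... | inside-G₃ s    = rank-restrict (λ {x} → before-in-G₃ {x = x}) (λ {c} → after-in-G₃ {c = c})
                               (region-G₃ L₃ v₃-first u s)

    shared : (∀ s → RankAtMost (D ✶ᵛ p₁ u) ⟨ ｛ u ｝ ∪ Before₁ s , U , ∅ ⟩ ⟨ ｛ u ｝ ∪ After₁ s , ∅ , U ⟩ (suc (suc k))) →
             SharedWidth≤ D (p₁ u) N (suc k)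
    shared region₁ = layout , cut
      where
      cut : ∀ t → RankAtMost (D ✶ᵛ p₁ u) (｛ p₁ u ｝ ∪ Before t) (｛ p₁ u ｝ ∪ After t) (suc (suc k))
      cut t with cut? t
      ... | inside-G₂ t≤b′ =
        rank-restrict (λ { (inj₁ e) → inj₁ e ; (inj₂ x∈) → inj₂ (before-in-G₂ t≤b′ x∈) })
                      (λ { (inj₁ refl) → tt ; (inj₂ c∈) → after-in-G₂ c∈ })
          (rank-insert-row _≟ₚ_ (p₁ u) (region-G₂ L₂ v₂-last u t≤b′))
      ... | inside-G₁ s≤a′ =
        rank-restrict (λ {x} → shared-before-in-G₁ s≤a′ {x}) (λ {c} → shared-after-in-G₁ {c = c}) (region₁ _)
      ... | inside-G₃ s =
        rank-restrict (λ { (inj₁ refl) → tt ; (inj₂ x∈) → before-in-G₃ x∈ })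
                      (λ { (inj₁ e) → inj₁ e ; (inj₂ c∈) → inj₂ (after-in-G₃ c∈) })
          (rank-insert-column _≟ₚ_ (p₁ u) (region-G₃ L₃ v₃-first u s))

  widths-at-p₁ : ∀ {k} → Simple G₁ → Pivotingᶠ.PivotWidths≤ G₁ a′ k →
    (Σ (FullLayout G₂ b′ (suc k)) λ L₂ → FullLayout.pos L₂ v₂ ≡ b′) →
    (Σ (FullLayout G₃ c′ (suc k)) λ L₃ → FullLayout.pos L₃ v₃ ≡ 0) →
    ∀ u → DeletedWidth≤ D (p₁ u) N (suc k) × SharedWidth≤ D (p₁ u) N (suc k)
  widths-at-p₁ simple₁ widths₁ (L₂ , v₂-last) (L₃ , v₃-first) u with u ≟ v₁ | widths₁ u
  ... | yes refl | (Lᵈ , rankᵈ) , (Lˢ , rankˢ) =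
    Concatenation.deleted Lˢ L₂ v₂-last L₃ v₃-first (λ s → region-G₁-at-v₁ simple₁ proj₁ proj₁ (rankˢ s)) ,
    Concatenation.shared Lᵈ L₂ v₂-last L₃ v₃-first (λ s → region-G₁-at-v₁-shared simple₁ proj₁ proj₁ (rankᵈ s))
  ... | no u≢v₁ | (Lᵈ , rankᵈ) , (Lˢ , rankˢ) =
    Concatenation.deleted Lᵈ L₂ v₂-last L₃ v₃-first (λ s → region-G₁ u u≢v₁ not-both (rankᵈ s)) ,
    Concatenation.shared Lˢ L₂ v₂-last L₃ v₃-first (λ s → region-G₁ u u≢v₁ not-both-shared (rankˢ s))
    where
    not-both : ∀ {s x x′} → Layout.Before Lᵈ s x → Layout.After Lᵈ s x′ → x ≡ v₁ → x′ ≢ v₁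
    not-both (_ , x<s) (_ , s≤x′) refl refl = separated (Layout.pos Lᵈ) x<s s≤x′ refl
    not-both-shared : ∀ {s x x′} → (｛ u ｝ ∪ Layout.Before Lˢ s) x → (｛ u ｝ ∪ Layout.After Lˢ s) x′ →
                      x ≡ v₁ → x′ ≢ v₁
    not-both-shared (inj₁ refl) _ u≡v₁ _ = u≢v₁ u≡v₁
    not-both-shared (inj₂ _) (inj₁ refl) _ u≡v₁ = u≢v₁ u≡v₁
    not-both-shared (inj₂ (_ , x<s)) (inj₂ (_ , s≤x′)) refl refl = separated (Layout.pos Lˢ) x<s s≤x′ refl

-- Induction along Δ_k

Invariant : ℕ → ∀ {n} → Graph n → Set
Invariant k {n} G = Simple G × PivotWidths≤ G (pred n) k

≅-preserves-Invariant : ∀ {k m n} {H : Graph m} {G : Graph n} → H ≅ G → Invariant k H → Invariant k G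
≅-preserves-Invariant {k} {G = G} (σ , G∘σ) (simple , widths) =
  T.simple simple , subst (λ N → PivotWidths≤ G N k) (cong pred (↔⇒≡ σ)) (T.pivot-widths widths)
  where
  module T = Transport _≟_ _≟_ {E′ = G} (σ ⟨$⟩ʳ_) (σ ⟨$⟩ˡ_) (λ _ → inverseˡ σ) (λ _ → inverseʳ σ) G∘σ

K₂-simple : Simple K₂
K₂-simple = (λ { zero zero → refl ; zero (suc zero) → refl ; (suc zero) zero → refl ; (suc zero) (suc zero) → refl })
          , (λ { zero → refl ; (suc zero) → refl })

K₂-Invariant : Invariant 0 K₂
K₂-Invariant = K₂-simple , λ w → (layout w , deleted w) , (layout w , shared w)
  where
  others-equal : ∀ {w x y : Fin 2} → x ≢ w → y ≢ w → x ≡ y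
  others-equal {zero}      {suc zero} {suc zero} _ _ = refl
  others-equal {suc zero}  {zero}     {zero}     _ _ = refl
  others-equal {zero}      {zero}                x≢w _ = contradiction refl x≢w
  others-equal {suc zero}  {suc zero}            x≢w _ = contradiction refl x≢w
  others-equal {zero}      {suc zero} {zero}     _ y≢w = contradiction refl y≢w
  others-equal {suc zero}  {zero}     {suc zero} _ y≢w = contradiction refl y≢w
  layout : ∀ w → Layout w 1
  layout w = record { pos = λ _ → 0 ; pos-injective = λ x≢w y≢w _ → others-equal x≢w y≢w ; pos-< = λ _ → s≤s z≤n }
  open Pivotingᶠ using (_✶ᵛ_)
  deleted : ∀ w t → RankAtMost (K₂ ✶ᵛ w) (λ x → x ≢ w × 0 < t) (λ c → c ≢ w × t ≤ 0) 0
  deleted w t = rank-of-zero λ (_ , 0<t) (_ , t≤0) → contradiction (ℕₚ.<-≤-trans 0<t t≤0) λ ()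
  shared : ∀ w t → RankAtMost (K₂ ✶ᵛ w) (λ x → w ≡ x ⊎ (x ≢ w × 0 < t)) (λ c → w ≡ c ⊎ (c ≢ w × t ≤ 0)) 1
  shared w zero = rank-add-outer {M₀ = λ _ _ → false} (λ _ → true) ((K₂ ✶ᵛ w) w)
    (λ { (inj₁ refl) _ → sym (xor-identityʳ _) ; (inj₂ (_ , ())) _ }) (rank-of-zero λ _ _ → refl)
  shared w (suc t) = rank-add-outer {M₀ = λ _ _ → false} (λ x → (K₂ ✶ᵛ w) x w) (λ _ → true)
    (λ { _ (inj₁ refl) → trans (sym (∧-identityʳ _)) (sym (xor-identityʳ _)) ; _ (inj₂ (_ , ())) })
    (rank-of-zero λ _ _ → refl)

splitAt⇒join : ∀ {m n} (i : Fin (m + n)) {s} → splitAt m i ≡ s → join m n s ≡ i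
splitAt⇒join {m} {n} i refl = Finₚ.join-splitAt m n i

module _ {a b c : ℕ} where

  encode : Part a b c → Fin (a + (b + c))
  encode = ⟨ (_↑ˡ (b + c)) , (λ j → a ↑ʳ (j ↑ˡ c)) , (λ l → a ↑ʳ (b ↑ʳ l)) ⟩

  decode-encode : ∀ p → decode a b c (encode p) ≡ p
  decode-encode (p₁ i) rewrite Finₚ.splitAt-↑ˡ a i (b + c) = refl
  decode-encode (p₂ j) rewrite Finₚ.splitAt-↑ʳ a (b + c) (j ↑ˡ c) | Finₚ.splitAt-↑ˡ b j c = refl
  decode-encode (p₃ l) rewrite Finₚ.splitAt-↑ʳ a (b + c) (b ↑ʳ l) | Finₚ.splitAt-↑ʳ b c l = refl

  encode-decode : ∀ x → encode (decode a b c x) ≡ x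
  encode-decode x with splitAt a x in split-x
  ... | inj₁ _ = splitAt⇒join x split-x
  ... | inj₂ j with splitAt b j in split-j
  ...   | inj₁ _ = trans (cong (a ↑ʳ_) (splitAt⇒join j split-j)) (splitAt⇒join x split-x)
  ...   | inj₂ _ = trans (cong (a ↑ʳ_) (splitAt⇒join j split-j)) (splitAt⇒join x split-x)

swap₁₂ : ∀ {a b c} → Part a b c → Part b a c
swap₁₂ = ⟨ p₂ , p₁ , p₃ ⟩

swap₁₃ : ∀ {a b c} → Part a b c → Part c b a
swap₁₃ = ⟨ p₃ , p₂ , p₁ ⟩

swap₁₂-involutive : ∀ {a b c} (p : Part a b c) → swap₁₂ (swap₁₂ p) ≡ p
swap₁₂-involutive (p₁ _) = refl
swap₁₂-involutive (p₂ _) = refl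
swap₁₂-involutive (p₃ _) = refl

swap₁₃-involutive : ∀ {a b c} (p : Part a b c) → swap₁₃ (swap₁₃ p) ≡ p
swap₁₃-involutive (p₁ _) = refl
swap₁₃-involutive (p₂ _) = refl
swap₁₃-involutive (p₃ _) = refl

module _ {a b c} {G₁ : Graph a} {G₂ : Graph b} {G₃ : Graph c} (v₁ : Fin a) (v₂ : Fin b) (v₃ : Fin c) where

  composeAdj-swap₁₂ : ∀ p q → composeAdj G₁ G₂ G₃ v₁ v₂ v₃ (swap₁₂ p) (swap₁₂ q) ≡ composeAdj G₂ G₁ G₃ v₂ v₁ v₃ p q
  composeAdj-swap₁₂ (p₁ _) (p₁ _) = refl
  composeAdj-swap₁₂ (p₁ _) (p₂ _) = refl
  composeAdj-swap₁₂ (p₁ _) (p₃ _) = refl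
  composeAdj-swap₁₂ (p₂ _) (p₁ _) = refl
  composeAdj-swap₁₂ (p₂ _) (p₂ _) = refl
  composeAdj-swap₁₂ (p₂ _) (p₃ _) = refl
  composeAdj-swap₁₂ (p₃ _) (p₁ _) = refl
  composeAdj-swap₁₂ (p₃ _) (p₂ _) = refl
  composeAdj-swap₁₂ (p₃ _) (p₃ _) = refl

  composeAdj-swap₁₃ : ∀ p q → composeAdj G₁ G₂ G₃ v₁ v₂ v₃ (swap₁₃ p) (swap₁₃ q) ≡ composeAdj G₃ G₂ G₁ v₃ v₂ v₁ p q
  composeAdj-swap₁₃ (p₁ _) (p₁ _) = refl
  composeAdj-swap₁₃ (p₁ _) (p₂ _) = refl
  composeAdj-swap₁₃ (p₁ _) (p₃ _) = refl
  composeAdj-swap₁₃ (p₂ _) (p₁ _) = refl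
  composeAdj-swap₁₃ (p₂ _) (p₂ _) = refl
  composeAdj-swap₁₃ (p₂ _) (p₃ _) = refl
  composeAdj-swap₁₃ (p₃ _) (p₁ _) = refl
  composeAdj-swap₁₃ (p₃ _) (p₂ _) = refl
  composeAdj-swap₁₃ (p₃ _) (p₃ _) = refl

positions-G₁-middle : ∀ a′ b′ c′ → suc b′ + (a′ + suc c′) ≡ a′ + (suc b′ + suc c′)
positions-G₁-middle = solve-∀

positions-G₂-middle : ∀ a′ b′ c′ → suc a′ + (b′ + suc c′) ≡ a′ + (suc b′ + suc c′)
positions-G₂-middle = solve-∀

positions-G₃-middle : ∀ a′ b′ c′ → suc b′ + (c′ + suc a′) ≡ a′ + (suc b′ + suc c′)
positions-G₃-middle = solve-∀

module _ {k : ℕ} where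

  pivot-last-of : ∀ {n} {G : Graph (suc n)} → Invariant k G → ∀ v →
                  Σ (FullLayout G n (suc k)) λ L → FullLayout.pos L v ≡ n
  pivot-last-of (simple , widths) v = Pivotingᶠ.pivot-last simple (proj₁ (widths v))

  pivot-first-of : ∀ {n} {G : Graph (suc n)} → Invariant k G → ∀ v →
                   Σ (FullLayout G n (suc k)) λ L → FullLayout.pos L v ≡ 0
  pivot-first-of (simple , widths) v = Pivotingᶠ.pivot-first simple (proj₁ (widths v))

  deltaCompose-Invariant : ∀ {a′ b′ c′} {G₁ : Graph (suc a′)} {G₂ : Graph (suc b′)} {G₃ : Graph (suc c′)} →
    Invariant k G₁ → Invariant k G₂ → Invariant k G₃ → ∀ v₁ v₂ v₃ →
    Invariant (suc k) (deltaCompose G₁ G₂ G₃ v₁ v₂ v₃)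
  deltaCompose-Invariant {a′} {b′} {c′} {G₁} {G₂} {G₃} I₁ I₂ I₃ v₁ v₂ v₃ =
    T.simple simple , T.pivot-widths widths
    where
    D : Part (suc a′) (suc b′) (suc c′) → Part (suc a′) (suc b′) (suc c′) → Bool
    D = composeAdj G₁ G₂ G₃ v₁ v₂ v₃
    open Pivoting (_≟ₚ_ {suc a′} {suc b′} {suc c′})
      using (DeletedWidth≤; SharedWidth≤) renaming (PivotWidths≤ to PivotWidthsᴾ≤)
    module T = Transport _≟ₚ_ _≟_ {E = D} {E′ = deltaCompose G₁ G₂ G₃ v₁ v₂ v₃}
      encode (decode (suc a′) (suc b′) (suc c′)) decode-encode (encode-decode {suc a′} {suc b′} {suc c′})
      (λ p q → cong₂ D (decode-encode p) (decode-encode q))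
    module T₁₂ = Transport _≟ₚ_ _≟ₚ_ {E′ = D} swap₁₂ swap₁₂ swap₁₂-involutive swap₁₂-involutive
      (composeAdj-swap₁₂ v₁ v₂ v₃)
    module T₁₃ = Transport _≟ₚ_ _≟ₚ_ {E′ = D} swap₁₃ swap₁₃ swap₁₃-involutive swap₁₃-involutive
      (composeAdj-swap₁₃ v₁ v₂ v₃)
    simple : Simple D
    simple = composeAdj-simple v₁ v₂ v₃ (proj₁ I₁) (proj₁ I₂) (proj₁ I₃)
    N : ℕ
    N = a′ + (suc b′ + suc c′)
    resize : ∀ {N′} w → N′ ≡ N → DeletedWidth≤ D w N′ (suc k) × SharedWidth≤ D w N′ (suc k) →
         DeletedWidth≤ D w N (suc k) × SharedWidth≤ D w N (suc k)
    resize w refl widths = widths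
    widths : PivotWidthsᴾ≤ D N (suc k)
    widths (p₁ u) = resize (p₁ u) (positions-G₁-middle a′ b′ c′)
      (Composition.widths-at-p₁ v₁ v₂ v₃ (proj₁ I₁) (proj₂ I₁) (pivot-last-of I₂ v₂) (pivot-first-of I₃ v₃) u)
    widths (p₂ u) = resize (p₂ u) (positions-G₂-middle a′ b′ c′)
      (Product.map T₁₂.deleted T₁₂.shared
        (Composition.widths-at-p₁ v₂ v₁ v₃ (proj₁ I₂) (proj₂ I₂) (pivot-last-of I₁ v₁) (pivot-first-of I₃ v₃) u))
    widths (p₃ u) = resize (p₃ u) (positions-G₃-middle a′ b′ c′)
      (Product.map T₁₃.deleted T₁₃.shared
        (Composition.widths-at-p₁ v₃ v₂ v₁ (proj₁ I₃) (proj₂ I₃) (pivot-last-of I₂ v₂) (pivot-first-of I₁ v₁) u))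

Δ⇒Invariant : ∀ {k n} {G : Graph n} → Δ k G → Invariant k G
Δ⇒Invariant (base K₂≅G) = ≅-preserves-Invariant K₂≅G K₂-Invariant
Δ⇒Invariant (step {a = zero} _ _ _ () _ _ _)
Δ⇒Invariant (step {a = suc _} {b = zero} _ _ _ _ () _ _)
Δ⇒Invariant (step {a = suc _} {b = suc _} {c = zero} _ _ _ _ _ () _)
Δ⇒Invariant (step {a = suc _} {b = suc _} {c = suc _} Δ₁ Δ₂ Δ₃ v₁ v₂ v₃ composition≅G) =
  ≅-preserves-Invariant composition≅G
    (deltaCompose-Invariant (Δ⇒Invariant Δ₁) (Δ⇒Invariant Δ₂) (Δ⇒Invariant Δ₃) v₁ v₂ v₃)

-- From positions to linear layouts

injective⇒surjective : ∀ {n} {f : Fin n → Fin n} → (∀ {x y} → f x ≡ f y → x ≡ y) → ∀ y → ∃ λ x → f x ≡ y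
injective⇒surjective {suc m} {f} f-injective y with any? (λ x → f x ≟ y)
... | yes found  = found
... | no missing = contradiction (Finₚ.injective⇒≤ punched-injective) ℕₚ.1+n≰n
  where
  y≢f : ∀ x → y ≢ f x
  y≢f x y≡fx = missing (x , sym y≡fx)
  punched-injective : ∀ {x z} → punchOut (y≢f x) ≡ punchOut (y≢f z) → x ≡ z
  punched-injective eq = f-injective (Finₚ.punchOut-injective (y≢f _) (y≢f _) eq)

layout⇒permutation : ∀ {n} {w : Fin (suc n)} (L : Layout w n) →
  Σ (Permutation′ n) λ σ → ∀ x → toℕ (σ ⟨$⟩ˡ x) ≡ Layout.pos L (punchIn w x)
layout⇒permutation {n} {w} L = permutation preimage position preimage-position position-preimage , toℕ-position
  where
  open Layout L
  position : Fin n → Fin n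
  position x = fromℕ< (pos-< (Finₚ.punchInᵢ≢i w x))
  toℕ-position : ∀ x → toℕ (position x) ≡ pos (punchIn w x)
  toℕ-position x = Finₚ.toℕ-fromℕ< _
  position-injective : ∀ {x y} → position x ≡ position y → x ≡ y
  position-injective {x} {y} eq = Finₚ.punchIn-injective w x y
    (pos-injective (Finₚ.punchInᵢ≢i w x) (Finₚ.punchInᵢ≢i w y)
      (trans (sym (toℕ-position x)) (trans (cong toℕ eq) (toℕ-position y))))
  preimage : Fin n → Fin n
  preimage y = proj₁ (injective⇒surjective position-injective y)
  position-preimage : ∀ y → position (preimage y) ≡ y
  position-preimage y = proj₂ (injective⇒surjective position-injective y)
  preimage-position : ∀ x → preimage (position x) ≡ x
  preimage-position x = position-injective (position-preimage (position x))

module _ {n} (σ : Permutation′ n) (i : ℕ) {x : Fin n} where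

  ∈prefix⇒< : x ∈ prefix σ i → toℕ (σ ⟨$⟩ˡ x) < i
  ∈prefix⇒< x∈ = ℕₚ.<ᵇ⇒< _ i (Equivalence.from T-≡ (trans (sym (lookup∘tabulate _ x)) ([]=⇒lookup x∈)))

  ∉prefix⇒≥ : x ∉ prefix σ i → i ≤ toℕ (σ ⟨$⟩ˡ x)
  ∉prefix⇒≥ x∉ = ℕₚ.≮⇒≥ λ lt → x∉ (lookup⇒[]= x _ (trans (lookup∘tabulate _ x) (Equivalence.to T-≡ (ℕₚ.<⇒<ᵇ lt))))

DeletedWidth≤⇒LinearRankWidthAtMost : ∀ {n k} {G : Graph (suc n)} {v} →
  Pivotingᶠ.DeletedWidth≤ G v n k → LinearRankWidthAtMost ((G ✶ v) ∖ v) k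
DeletedWidth≤⇒LinearRankWidthAtMost {G = G} {v} (L , rank) with layout⇒permutation L
... | σ , position = σ , λ i _ → rank⇒cut-rank ((G ✶ v) ∖ v) (prefix σ i)
  (rank-pullback (punchIn v) (punchIn v) (λ _ → true) (λ _ → true)
    (λ {x} x∈ _ → Finₚ.punchInᵢ≢i v x , subst (_< i) (position x) (∈prefix⇒< σ i x∈))
    (λ {c} c∉ _ → Finₚ.punchInᵢ≢i v c , subst (i ≤_) (position c) (∉prefix⇒≥ σ i c∉))
    (λ _ _ → refl) (rank i))

lemma3p10 : (k n : ℕ) (G : Graph (suc n)) → Δ k G →
    (v : Fin (suc n)) → LinearRankWidthAtMost ((G ✶ v) ∖ v) k
lemma3p10 k n G ΔG v = DeletedWidth≤⇒LinearRankWidthAtMost {G = G} (proj₁ (proj₂ (Δ⇒Invariant ΔG) v))
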